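{- Let $M,M'$ be algebraic $\lambda$-terms with $M\Rrightarrow M'$. Then $M$ is Taylor normalizable iff $M'$ is Taylor normalizable.
   Context: Resource terms $s::=x\mid\lambda x.s\mid\langle s\rangle\bar t$, monomials $\bar t=[t_1..t_n]$ finite multisets of resource terms, up to $\alpha$; multilinear substitution $e\langle\bar u/x\rangle=\sum_f e[u_1/x_{f(1)},\dots,u_n/x_{f(n)}]$ over bijections $f$ from $\{1..n\}$ to the free occurrences of $x$ in $e$; resource reduction $\to_r$ is the contextual closure of $\langle\lambda x.s\rangle\bar t\to_r s\langle\bar t/x\rangle$ (on finite formal sums of expressions, constructors extended linearly). Normal expressions contain no $\langle\lambda x.s\rangle\bar t$. $e\rightsquigarrow^*e'$ iff $e\to_r^*\varepsilon'$ for a finite sum $\varepsilon'$ containing $e'$. $\mathfrak N$: sets $\mathcal E$ of resource expressions with finitely many free variables overall such that for every normal $e'$, $\{e\in\mathcal E:e\rightsquigarrow^*e'\}$ is finite. $\mathcal S$ is a commutative semiring. Algebraic $\lambda$-terms $M::=x\mid\lambda x.M\mid(M)N\mid0\mid a\cdot M\mid M+N$ ($a\in\mathcal S$) up to $\alpha$ and the congruence generated by $\lambda x.0=0$, $\lambda x.(a\cdot M)=a\cdot\lambda x.M$, $\lambda x.(M+N)=\lambda x.M+\lambda x.N$, $(0)P=0$, $(a\cdot M)P=a\cdot(M)P$, $(M+N)P=(M)P+(N)P$; canonical forms $M::=S\mid0\mid a\cdot M\mid M+N$, $S::=x\mid\lambda x.S\mid(S)M$. Taylor support $\mathcal T^*(M)$: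 $\{x\}$; $\{\lambda x.s:s\in\mathcal T^*(M)\}$; $\{\langle s\rangle[t_1..t_n]:s\in\mathcal T^*(M),n\ge0,t_i\in\mathcal T^*(N)\}$ for $(M)N$; $\emptyset$ for $0$; $\mathcal T^*(M)$ for $a\cdot M$; $\mathcal T^*(M)\cup\mathcal T^*(N)$ for $M+N$. $M$ is Taylor normalizable if $\mathcal T^*(M)\in\mathfrak N$. Parallel $\beta$-reduction $\Rrightarrow$ on canonical terms: $x\Rrightarrow x$; $S\Rrightarrow M'\Rightarrow\lambda x.S\Rrightarrow\lambda x.M'$; $S\Rrightarrow M'$, $N\Rrightarrow N'\Rightarrow(S)N\Rrightarrow(M')N'$ and $(\lambda x.S)N\Rrightarrow M'[N'/x]$ (capture-avoiding substitution); $0\Rrightarrow0$; $M\Rrightarrow M'\Rightarrow a\cdot M\Rrightarrow a\cdot M'$; $M\Rrightarrow M',N\Rrightarrow N'\Rightarrow M+N\Rrightarrow M'+N'$. -}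

module Defs where

open import Level using (Level)
open import Data.Nat using (ℕ; zero; suc; _<_; _≥_; _≤?_; _<?_; _≟_; pred)
open import Data.List using (List; []; _∷_; _++_; map; concatMap)
open import Data.List.Relation.Unary.All using (All)
open import Data.List.Relation.Unary.Any using (Any)
open import Data.Product using (Σ; ∃; _×_; _,_)
open import Data.Sum using (_⊎_)
open import Data.Empty using (⊥)
open import Data.Unit using (⊤)
open import Relation.Nullary using (yes; no)
open import Relation.Binary.PropositionalEquality using (_≡_)
open import Relation.Binary.Construct.Closure.ReflexiveTransitive using (Star)

-- Resource terms (de Bruijn indices, so terms are taken up to α).
-- A monomial [t₁..tₙ] is represented by a list; lists are identified up
-- to permutation through the equivalence _≈_ below (multiset equality).

data RTerm : Set where
  var : ℕ → RTerm
  lam : RTerm → RTerm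
  app : RTerm → List RTerm → RTerm

Bag : Set
Bag = List RTerm

mutual
  data _≈_ : RTerm → RTerm → Set where
    var : ∀ x → var x ≈ var x
    lam : ∀ {s s'} → s ≈ s' → lam s ≈ lam s'
    app : ∀ {s s' ts ts'} → s ≈ s' → ts ≈b ts' → app s ts ≈ app s' ts'

  data _≈b_ : Bag → Bag → Set where
    []  : [] ≈b []
    _∷_ : ∀ {t u ts us₁ us₂} → t ≈ u → ts ≈b (us₁ ++ us₂) →
          (t ∷ ts) ≈b (us₁ ++ u ∷ us₂)

mutual
  shift : ℕ → RTerm → RTerm
  shift c (var y) with y <? c
  ... | yes _ = var y
  ... | no  _ = var (suc y)
  shift c (lam s) = lam (shift (suc c) s)
  shift c (app s ts) = app (shift c s) (shiftBag c ts)

  shiftBag : ℕ → Bag → Bag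
  shiftBag c [] = []
  shiftBag c (t ∷ ts) = shift c t ∷ shiftBag c ts

splits : ∀ {a} {A : Set a} → List A → List (List A × List A)
splits [] = ([] , []) ∷ []
splits (x ∷ xs) =
  concatMap (λ { (l , r) → (x ∷ l , r) ∷ (l , x ∷ r) ∷ [] }) (splits xs)

-- Multilinear substitution  s⟨ū / k⟩  as a finite formal sum (a list).
-- msub k s us : replace the free occurrences of index k in s bijectively
-- by the elements of us (already lifted to the current depth), and
-- decrement the free indices > k.  One summand per bijection.

mutual
  msub : ℕ → RTerm → Bag → List RTerm
  msub k (var y) us with y ≟ k | y <? k
  msub k (var y) (u ∷ []) | yes _ | _ = u ∷ []
  msub k (var y) _        | yes _ | _ = []
  msub k (var y) []       | no _  | yes _ = var y ∷ []
  msub k (var y) []       | no _  | no _  = var (pred y) ∷ []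
  msub k (var y) (_ ∷ _)  | no _  | _ = []
  msub k (lam s) us = map lam (msub (suc k) s (shiftBag 0 us))
  msub k (app s ts) us =
    concatMap (λ { (l , r) →
      concatMap (λ s' → map (app s') (msubBag k ts r)) (msub k s l) })
      (splits us)

  msubBag : ℕ → Bag → Bag → List Bag
  msubBag k [] [] = [] ∷ []
  msubBag k [] (_ ∷ _) = []
  msubBag k (t ∷ ts) us =
    concatMap (λ { (l , r) →
      concatMap (λ t' → map (t' ∷_) (msubBag k ts r)) (msub k t l) })
      (splits us)

mutual
  data _⟶_ : RTerm → List RTerm → Set where
    β    : ∀ s ts → app (lam s) ts ⟶ msub 0 s ts
    lamc : ∀ {s ε} → s ⟶ ε → lam s ⟶ map lam ε
    appl : ∀ {s ε} ts → s ⟶ ε → app s ts ⟶ map (λ s' → app s' ts) ε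
    appr : ∀ s {ts bs} → ts ⟶b bs → app s ts ⟶ map (app s) bs

  data _⟶b_ : Bag → List Bag → Set where
    here  : ∀ {t ε} ts → t ⟶ ε → (t ∷ ts) ⟶b map (_∷ ts) ε
    there : ∀ t {ts bs} → ts ⟶b bs → (t ∷ ts) ⟶b map (t ∷_) bs

data _⟶s_ : List RTerm → List RTerm → Set where
  step : ∀ ε₁ {e ε} ε₂ → e ⟶ ε → (ε₁ ++ e ∷ ε₂) ⟶s (ε₁ ++ ε ++ ε₂)

_⟶s*_ : List RTerm → List RTerm → Set
_⟶s*_ = Star _⟶s_

_⇝*_ : RTerm → RTerm → Set
e ⇝* e' = ∃ λ ε' → ((e ∷ []) ⟶s* ε') × Any (e' ≈_) ε'

mutual
  data Normal : RTerm → Set where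
    var : ∀ x → Normal (var x)
    lam : ∀ {s} → Normal s → Normal (lam s)
    app : ∀ {s ts} → NormalHead s → All Normal ts → Normal (app s ts)

  data NormalHead : RTerm → Set where
    var : ∀ x → NormalHead (var x)
    app : ∀ {s ts} → NormalHead s → All Normal ts → NormalHead (app s ts)

mutual
  FVBelow : ℕ → RTerm → Set
  FVBelow n (var y) = y < n
  FVBelow n (lam s) = FVBelow (suc n) s
  FVBelow n (app s ts) = FVBelow n s × FVBelowBag n ts

  FVBelowBag : ℕ → Bag → Set
  FVBelowBag n [] = ⊤
  FVBelowBag n (t ∷ ts) = FVBelow n t × FVBelowBag n ts

RSet : Set₁
RSet = RTerm → Set

𝔑 : RSet → Set
𝔑 ℰ =
  (∃ λ n → ∀ e → ℰ e → FVBelow n e) ×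
  (∀ e' → Normal e' →
     ∃ λ (L : List RTerm) → ∀ e → ℰ e → e ⇝* e' → Any (e ≈_) L)

-- Algebraic λ-terms in canonical form over scalars A
--   M ::= S | 0 | a·M | M+N ,  S ::= x | λx.S | (S)M

module _ {a : Level} (A : Set a) where
  mutual
    data CTerm : Set a where
      ι    : STerm → CTerm
      𝟘    : CTerm
      _·_  : A → CTerm → CTerm
      _⊕_  : CTerm → CTerm → CTerm

    data STerm : Set a where
      var : ℕ → STerm
      lam : STerm → STerm
      app : STerm → CTerm → STerm

module _ {a : Level} {A : Set a} where
  -- λx.M and (M)P computed modulo the congruence
  lamC : CTerm A → CTerm A
  lamC (ι S) = ι (lam S)
  lamC 𝟘 = 𝟘
  lamC (c · M) = c · lamC M
  lamC (M ⊕ N) = lamC M ⊕ lamC N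

  appC : CTerm A → CTerm A → CTerm A
  appC (ι S) P = ι (app S P)
  appC 𝟘 P = 𝟘
  appC (c · M) P = c · appC M P
  appC (M ⊕ N) P = appC M P ⊕ appC N P

  mutual
    shiftM : ℕ → CTerm A → CTerm A
    shiftM c (ι S) = ι (shiftS c S)
    shiftM c 𝟘 = 𝟘
    shiftM c (d · M) = d · shiftM c M
    shiftM c (M ⊕ N) = shiftM c M ⊕ shiftM c N

    shiftS : ℕ → STerm A → STerm A
    shiftS c (var y) with y <? c
    ... | yes _ = var y
    ... | no  _ = var (suc y)
    shiftS c (lam S) = lam (shiftS (suc c) S)
    shiftS c (app S M) = app (shiftS c S) (shiftM c M)

  mutual
    substM : ℕ → CTerm A → CTerm A → CTerm A
    substM k N (ι S) = substS k N S
    substM k N 𝟘 = 𝟘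
    substM k N (d · M) = d · substM k N M
    substM k N (M ⊕ P) = substM k N M ⊕ substM k N P

    substS : ℕ → CTerm A → STerm A → CTerm A
    substS k N (var y) with y ≟ k | y <? k
    ... | yes _ | _ = N
    ... | no _ | yes _ = ι (var y)
    ... | no _ | no _ = ι (var (pred y))
    substS k N (lam S) = lamC (substS (suc k) (shiftM 0 N) S)
    substS k N (app S P) = appC (substS k N S) (substM k N P)

  data _⇛_ : CTerm A → CTerm A → Set a where
    var  : ∀ x → ι (var x) ⇛ ι (var x)
    lam  : ∀ {S M'} → ι S ⇛ M' → ι (lam S) ⇛ lamC M'
    app  : ∀ {S M' N N'} → ι S ⇛ M' → N ⇛ N' → ι (app S N) ⇛ appC M' N'
    beta : ∀ {S M' N N'} → ι S ⇛ M' → N ⇛ N' →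
           ι (app (lam S) N) ⇛ substM 0 N' M'
    zero : 𝟘 ⇛ 𝟘
    scal : ∀ {M M'} c → M ⇛ M' → (c · M) ⇛ (c · M')
    plus : ∀ {M M' N N'} → M ⇛ M' → N ⇛ N' → (M ⊕ N) ⇛ (M' ⊕ N')

  mutual
    𝒯 : CTerm A → RSet
    𝒯 (ι S) e = 𝒯S S e
    𝒯 𝟘 e = ⊥
    𝒯 (c · M) e = 𝒯 M e
    𝒯 (M ⊕ N) e = 𝒯 M e ⊎ 𝒯 N e

    𝒯S : STerm A → RSet
    𝒯S (var x) (var y) = x ≡ y
    𝒯S (lam S) (lam s) = 𝒯S S s
    𝒯S (app S N) (app s ts) = 𝒯S S s × All (𝒯 N) ts
    𝒯S _ _ = ⊥

  TaylorNormalizable : CTerm A → Set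
  TaylorNormalizable M = 𝔑 (𝒯 M)

-- A derivation d : M ⇛ M' marks, in each s ∈ 𝒯(M), the redexes it fires, and 𝒯(M') is
-- exactly the set of summands of the complete developments of these marked terms.
-- A set with boundedly many free variables is in 𝔑 iff, for each normal e', the terms
-- reducing to e' have bounded size, so it suffices to transport such size bounds.
-- Forward: a development is a reduct of s and is no larger than s.  Backward: if
-- s ⇝* e' with e' normal, residuals of the marking along the reduction show that e'
-- is a reduct of some development t of s; and s is at most ⇛-weight d times larger
-- than t, since a resource substitution erases neither its body nor its argument bag.

module Submission where

open import Defs
open import Level using (Level)
open import Algebra.Bundles using (CommutativeSemiring; CommutativeMonoid)
open import Function.Bundles using (_⇔_; mk⇔)
open import Data.Nat using (ℕ; zero; suc; _<_; _≤_; _<?_; _≟_; z≤n; s≤s; s≤s⁻¹; _+_; _*_; _⊔_)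
open import Data.Nat.Properties
open import Data.Nat.ListAction using (sum)
open import Data.Nat.ListAction.Properties using (sum-↭)
open import Data.List using (List; []; _∷_; _++_; map; concatMap; length; upTo)
open import Data.List.Properties using (∷-injective; ++-assoc; ++-conicalˡ)
open import Data.List.Relation.Binary.Permutation.Propositional
  using (_↭_; ↭-refl; ↭-sym; ↭-trans; prep; swap; ↭-reflexive)
import Data.List.Relation.Binary.Permutation.Propositional as ↭
open import Data.List.Relation.Binary.Permutation.Propositional.Properties
  using ( ↭-empty-inv; ↭-singleton-inv; ↭-map-inv; All-resp-↭; ∈-resp-↭; drop-mid; shifts
        ; ++⁺; ++⁺ˡ; ++⁺ʳ; ++-commutativeMonoid)
  renaming (shift to ↭-shift; map⁺ to ↭-map⁺; ++-identityʳ to ↭-++-identityʳ)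
open import Data.List.Relation.Unary.Any using (here; there)
open import Data.List.Relation.Unary.All using (All; []; _∷_)
open import Data.List.Relation.Unary.All.Properties using (++⁻ˡ; ++⁻ʳ; ++⁻)
  renaming (++⁺ to All-++⁺)
open import Data.List.Membership.Propositional using (_∈_; lose; find)
open import Data.List.Membership.Propositional.Properties
  using ( ∈-map⁺; ∈-map⁻; ∈-++⁺ˡ; ∈-++⁺ʳ; ∈-++⁻; ∈-∃++; ∈-concatMap⁺; ∈-concatMap⁻
        ; ∈-insert; ∈-upTo⁺)
open import Data.Product using (Σ; ∃; ∃₂; _×_; _,_; proj₂)
open import Data.Sum using (inj₁; inj₂)
open import Data.Empty using (⊥-elim)
open import Relation.Nullary using (yes; no)
open import Function using (_∘_)
open import Relation.Binary.PropositionalEquality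
open import Relation.Binary.Construct.Closure.ReflexiveTransitive using (Star; ε; _◅_; _◅◅_; gmap)
import Algebra.Properties.CommutativeSemigroup as CommSemigroupProperties

open CommSemigroupProperties +-commutativeSemigroup using () renaming (interchange to +-interchange)
open CommSemigroupProperties (CommutativeMonoid.commutativeSemigroup (++-commutativeMonoid {A = RTerm}))
  using () renaming (interchange to ++-interchange)

shift-< : ∀ {c y} → y < c → shift c (var y) ≡ var y
shift-< {c} {y} y<c with y <? c
... | yes _ = refl
... | no y≮c = ⊥-elim (y≮c y<c)

shift-≥ : ∀ {c y} → c ≤ y → shift c (var y) ≡ var (suc y)
shift-≥ {c} {y} c≤y with y <? c
... | yes y<c = ⊥-elim (<⇒≱ y<c c≤y)
... | no _ = refl

shift-var : ∀ c y → ∃ λ y' → shift c (var y) ≡ var y'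
shift-var c y with <-≤-connex y c
... | inj₁ y<c = y , shift-< y<c
... | inj₂ c≤y = suc y , shift-≥ c≤y

shiftBag-map : ∀ c ts → shiftBag c ts ≡ map (shift c) ts
shiftBag-map c [] = refl
shiftBag-map c (t ∷ ts) = cong (shift c t ∷_) (shiftBag-map c ts)

shiftBag-++ : ∀ c xs ys → shiftBag c (xs ++ ys) ≡ shiftBag c xs ++ shiftBag c ys
shiftBag-++ c [] ys = refl
shiftBag-++ c (x ∷ xs) ys = cong (shift c x ∷_) (shiftBag-++ c xs ys)

shiftBag-≡[] : ∀ c {us} → shiftBag c us ≡ [] → us ≡ []
shiftBag-≡[] c {[]} _ = refl

shiftBag-↭ : ∀ c {xs ys} → xs ↭ ys → shiftBag c xs ↭ shiftBag c ys
shiftBag-↭ c {xs} {ys} p rewrite shiftBag-map c xs | shiftBag-map c ys = ↭-map⁺ (shift c) p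

shiftBag-↭-++ : ∀ c {us} a b → us ↭ a ++ b → shiftBag c us ↭ shiftBag c a ++ shiftBag c b
shiftBag-↭-++ c a b p = subst (_ ↭_) (shiftBag-++ c a b) (shiftBag-↭ c p)

map-++⁻ : ∀ {A B : Set} (f : A → B) xs {ys zs} → map f xs ≡ ys ++ zs →
  ∃₂ λ ys₀ zs₀ → xs ≡ ys₀ ++ zs₀ × ys ≡ map f ys₀ × zs ≡ map f zs₀
map-++⁻ f xs {[]} refl = [] , xs , refl , refl , refl
map-++⁻ f (x ∷ xs) {y ∷ ys} eq with ∷-injective eq
... | refl , eq' with map-++⁻ f xs {ys} eq'
... | ys₀ , zs₀ , refl , refl , refl = x ∷ ys₀ , zs₀ , refl , refl , refl

shiftBag-↭-++⁻ : ∀ c {us a b} → shiftBag c us ↭ a ++ b →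
  ∃₂ λ a₀ b₀ → us ↭ a₀ ++ b₀ × a ≡ shiftBag c a₀ × b ≡ shiftBag c b₀
shiftBag-↭-++⁻ c {us} {a} {b} p rewrite shiftBag-map c us with ↭-map-inv (shift c) p
... | ys , eq , q with map-++⁻ (shift c) ys {a} {b} (sym eq)
... | a₀ , b₀ , refl , refl , refl =
  a₀ , b₀ , q , sym (shiftBag-map c a₀) , sym (shiftBag-map c b₀)

mutual
  shift-shift : ∀ {d c} → d ≤ c → ∀ u → shift (suc c) (shift d u) ≡ shift d (shift c u)
  shift-shift {d} {c} d≤c (var y) with <-≤-connex y d
  ... | inj₁ y<d
    rewrite shift-< y<d | shift-< {suc c} (m≤n⇒m≤1+n (≤-trans y<d d≤c))
          | shift-< (<-≤-trans y<d d≤c) | shift-< y<d = refl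
  ... | inj₂ d≤y with <-≤-connex y c
  ...   | inj₁ y<c rewrite shift-≥ d≤y | shift-< {suc c} (s≤s y<c) | shift-< y<c | shift-≥ d≤y = refl
  ...   | inj₂ c≤y
    rewrite shift-≥ d≤y | shift-≥ {suc c} (s≤s c≤y) | shift-≥ c≤y | shift-≥ (m≤n⇒m≤1+n d≤y)
    = refl
  shift-shift d≤c (lam s) = cong lam (shift-shift (s≤s d≤c) s)
  shift-shift d≤c (app s ts) = cong₂ app (shift-shift d≤c s) (shiftBag-shiftBag d≤c ts)

  shiftBag-shiftBag : ∀ {d c} → d ≤ c → ∀ ts →
    shiftBag (suc c) (shiftBag d ts) ≡ shiftBag d (shiftBag c ts)
  shiftBag-shiftBag d≤c [] = refl
  shiftBag-shiftBag d≤c (t ∷ ts) = cong₂ _∷_ (shift-shift d≤c t) (shiftBag-shiftBag d≤c ts)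

mutual
  data Sub : ℕ → RTerm → Bag → RTerm → Set where
    hit : ∀ {k u} → Sub k (var k) (u ∷ []) u
    lo  : ∀ {k y} → y < k → Sub k (var y) [] (var y)
    hi  : ∀ {k y} → k ≤ y → Sub k (var (suc y)) [] (var y)
    lam : ∀ {k s us v} → Sub (suc k) s (shiftBag 0 us) v → Sub k (lam s) us (lam v)
    app : ∀ {k s ts us us₁ us₂ v vs} → us ↭ us₁ ++ us₂ → Sub k s us₁ v →
          SubB k ts us₂ vs → Sub k (app s ts) us (app v vs)

  data SubB : ℕ → Bag → Bag → Bag → Set where
    []   : ∀ {k} → SubB k [] [] []
    cons : ∀ {k t ts us us₁ us₂ v vs} → us ↭ us₁ ++ us₂ → Sub k t us₁ v →
           SubB k ts us₂ vs → SubB k (t ∷ ts) us (v ∷ vs)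

Sub-resp-↭ : ∀ {k s us us' v} → Sub k s us v → us ↭ us' → Sub k s us' v
Sub-resp-↭ hit p rewrite ↭-singleton-inv (↭-sym p) = hit
Sub-resp-↭ (lo y<k) p rewrite ↭-empty-inv (↭-sym p) = lo y<k
Sub-resp-↭ (hi k≤y) p rewrite ↭-empty-inv (↭-sym p) = hi k≤y
Sub-resp-↭ (lam σ) p = lam (Sub-resp-↭ σ (shiftBag-↭ 0 p))
Sub-resp-↭ (app q σ τ) p = app (↭-trans (↭-sym p) q) σ τ

SubB-resp-↭ : ∀ {k ts us us' vs} → SubB k ts us vs → us ↭ us' → SubB k ts us' vs
SubB-resp-↭ [] p rewrite ↭-empty-inv (↭-sym p) = []
SubB-resp-↭ (cons q σ τ) p = cons (↭-trans (↭-sym p) q) σ τ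

data SubVar (k y : ℕ) : Bag → RTerm → Set where
  hit : ∀ {u} → y ≡ k → SubVar k y (u ∷ []) u
  lo  : y < k → SubVar k y [] (var y)
  hi  : ∀ {y₀} → y ≡ suc y₀ → k ≤ y₀ → SubVar k y [] (var y₀)

Sub-var⁻ : ∀ {k y us w} → Sub k (var y) us w → SubVar k y us w
Sub-var⁻ hit = hit refl
Sub-var⁻ (lo y<k) = lo y<k
Sub-var⁻ (hi k≤y) = hi refl k≤y

Sub-≡var⁻ : ∀ {k s y us w} → s ≡ var y → Sub k s us w → SubVar k y us w
Sub-≡var⁻ refl = Sub-var⁻

mutual
  Sub-shift-above : ∀ {k s us v c} → Sub k s us v → k ≤ c →
    Sub k (shift (suc c) s) (shiftBag c us) (shift c v)
  Sub-shift-above {k} {c = c} hit k≤c rewrite shift-< {suc c} {k} (s≤s k≤c) = hit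
  Sub-shift-above {c = c} (lo y<k) k≤c
    rewrite shift-< {suc c} (m≤n⇒m≤1+n (≤-trans y<k k≤c)) | shift-< {c} (<-≤-trans y<k k≤c) = lo y<k
  Sub-shift-above {c = c} (hi {y = y} k≤y) k≤c with <-≤-connex y c
  ... | inj₁ y<c rewrite shift-< {suc c} (s≤s y<c) | shift-< y<c = hi k≤y
  ... | inj₂ c≤y rewrite shift-≥ {suc c} (s≤s c≤y) | shift-≥ c≤y = hi (m≤n⇒m≤1+n k≤y)
  Sub-shift-above {c = c} (lam {us = us} σ) k≤c =
    lam (subst (λ z → Sub _ _ z _) (shiftBag-shiftBag z≤n us) (Sub-shift-above σ (s≤s k≤c)))
  Sub-shift-above {c = c} (app {us₁ = a} {b} p σ τ) k≤c =
    app (shiftBag-↭-++ c a b p) (Sub-shift-above σ k≤c) (SubB-shift-above τ k≤c)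

  SubB-shift-above : ∀ {k ts us vs c} → SubB k ts us vs → k ≤ c →
    SubB k (shiftBag (suc c) ts) (shiftBag c us) (shiftBag c vs)
  SubB-shift-above [] k≤c = []
  SubB-shift-above {c = c} (cons {us₁ = a} {b} p σ τ) k≤c =
    cons (shiftBag-↭-++ c a b p) (Sub-shift-above σ k≤c) (SubB-shift-above τ k≤c)

mutual
  Sub-shift-below : ∀ {k s us v c} → Sub k s us v → c ≤ k →
    Sub (suc k) (shift c s) (shiftBag c us) (shift c v)
  Sub-shift-below {k} {c = c} hit c≤k rewrite shift-≥ {c} {k} c≤k = hit
  Sub-shift-below {k} {c = c} (lo {y = y} y<k) c≤k with <-≤-connex y c
  ... | inj₁ y<c rewrite shift-< y<c = lo (m≤n⇒m≤1+n y<k)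
  ... | inj₂ c≤y rewrite shift-≥ c≤y = lo (s≤s y<k)
  Sub-shift-below {c = c} (hi {y = y} k≤y) c≤k
    rewrite shift-≥ {c} {suc y} (m≤n⇒m≤1+n (≤-trans c≤k k≤y)) | shift-≥ {c} {y} (≤-trans c≤k k≤y)
    = hi (s≤s k≤y)
  Sub-shift-below {c = c} (lam {us = us} σ) c≤k =
    lam (subst (λ z → Sub _ _ z _) (shiftBag-shiftBag z≤n us) (Sub-shift-below σ (s≤s c≤k)))
  Sub-shift-below {c = c} (app {us₁ = a} {b} p σ τ) c≤k =
    app (shiftBag-↭-++ c a b p) (Sub-shift-below σ c≤k) (SubB-shift-below τ c≤k)

  SubB-shift-below : ∀ {k ts us vs c} → SubB k ts us vs → c ≤ k →
    SubB (suc k) (shiftBag c ts) (shiftBag c us) (shiftBag c vs)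
  SubB-shift-below [] c≤k = []
  SubB-shift-below {c = c} (cons {us₁ = a} {b} p σ τ) c≤k =
    cons (shiftBag-↭-++ c a b p) (Sub-shift-below σ c≤k) (SubB-shift-below τ c≤k)

Sub-shift-above-var⁻ : ∀ {k c} y {us v'} → Sub k (shift (suc c) (var y)) (shiftBag c us) v' → k ≤ c →
  ∃ λ v → Sub k (var y) us v × v' ≡ shift c v
Sub-shift-above-var⁻ {k} {c} y {us} σ k≤c with <-≤-connex y (suc c) | us
... | inj₁ y≤c | [] with Sub-≡var⁻ (shift-< y≤c) σ
...   | lo y<k = var y , lo y<k , sym (shift-< (<-≤-trans y<k k≤c))
...   | hi {y₀} refl k≤y₀ = var y₀ , hi k≤y₀ , sym (shift-< (s≤s⁻¹ y≤c))
Sub-shift-above-var⁻ {k} {c} y σ k≤c | inj₁ y≤c | u ∷ [] with Sub-≡var⁻ (shift-< y≤c) σ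
...   | hit refl = u , hit , refl
Sub-shift-above-var⁻ {k} {c} y σ k≤c | inj₂ c<y | [] with Sub-≡var⁻ (shift-≥ c<y) σ
...   | lo y<k = ⊥-elim (<⇒≱ (≤-trans y<k k≤c) (m≤n⇒m≤1+n (≤-trans (n≤1+n c) c<y)))
Sub-shift-above-var⁻ {k} {c} (suc y₁) σ k≤c | inj₂ (s≤s c≤y₁) | [] | hi refl k≤y =
  var y₁ , hi (≤-trans k≤c c≤y₁) , sym (shift-≥ c≤y₁)
Sub-shift-above-var⁻ {k} {c} y σ k≤c | inj₂ c<y | u ∷ [] with Sub-≡var⁻ (shift-≥ c<y) σ
...   | hit refl = ⊥-elim (<⇒≱ k≤c (≤-trans (n≤1+n c) c<y))
Sub-shift-above-var⁻ {k} {c} y σ k≤c | _ | _ ∷ _ ∷ _ with shift-var (suc c) y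
... | y' , eq with Sub-≡var⁻ eq σ
... | ()

mutual
  Sub-shift-above⁻ : ∀ {k c} s {us v'} → Sub k (shift (suc c) s) (shiftBag c us) v' → k ≤ c →
    ∃ λ v → Sub k s us v × v' ≡ shift c v
  Sub-shift-above⁻ (var y) σ k≤c = Sub-shift-above-var⁻ y σ k≤c
  Sub-shift-above⁻ {k} {c} (lam s) {us} (lam σ) k≤c
    with Sub-shift-above⁻ s (subst (λ z → Sub (suc k) _ z _) (sym (shiftBag-shiftBag {0} {c} z≤n us)) σ)
                          (s≤s k≤c)
  ... | v , σ' , refl = lam v , lam σ' , refl
  Sub-shift-above⁻ {k} {c} (app s ts) {us} (app {us₁ = a} {b} p σ τ) k≤c
    with shiftBag-↭-++⁻ c {us} {a} {b} p
  ... | a₀ , b₀ , q , refl , refl with Sub-shift-above⁻ s σ k≤c | SubB-shift-above⁻ ts τ k≤c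
  ... | v , σ' , refl | vs , τ' , refl = app v vs , app q σ' τ' , refl

  SubB-shift-above⁻ : ∀ {k c} ts {us vs'} → SubB k (shiftBag (suc c) ts) (shiftBag c us) vs' → k ≤ c →
    ∃ λ vs → SubB k ts us vs × vs' ≡ shiftBag c vs
  SubB-shift-above⁻ [] {[]} [] k≤c = [] , [] , refl
  SubB-shift-above⁻ (t ∷ ts) {us} (cons {us₁ = a} {b} p σ τ) k≤c with shiftBag-↭-++⁻ _ {us} {a} {b} p
  ... | a₀ , b₀ , q , refl , refl with Sub-shift-above⁻ t σ k≤c | SubB-shift-above⁻ ts τ k≤c
  ... | v , σ' , refl | vs , τ' , refl = v ∷ vs , cons q σ' τ' , refl


Sub-shift-below-var⁻ : ∀ {k c} y {us v'} → Sub (suc k) (shift c (var y)) (shiftBag c us) v' → c ≤ k →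
  ∃ λ v → Sub k (var y) us v × v' ≡ shift c v
Sub-shift-below-var⁻ {k} {c} y {us} σ c≤k with <-≤-connex y c | us
... | inj₁ y<c | [] with Sub-≡var⁻ (shift-< y<c) σ
...   | lo _ = var y , lo (<-≤-trans y<c c≤k) , sym (shift-< y<c)
...   | hi refl k<y = ⊥-elim (<⇒≱ y<c (≤-trans c≤k (≤-trans (n≤1+n k) (m≤n⇒m≤1+n k<y))))
Sub-shift-below-var⁻ {k} {c} y σ c≤k | inj₁ y<c | u ∷ [] with Sub-≡var⁻ (shift-< y<c) σ
...   | hit refl = ⊥-elim (<⇒≱ y<c (m≤n⇒m≤1+n c≤k))
Sub-shift-below-var⁻ {k} {c} y σ c≤k | inj₂ c≤y | [] with Sub-≡var⁻ (shift-≥ c≤y) σ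
...   | lo (s≤s y<k) = var y , lo y<k , sym (shift-≥ c≤y)
Sub-shift-below-var⁻ {k} {c} (suc y₁) σ c≤k | inj₂ c≤y | [] | hi refl (s≤s k≤y₁) =
  var y₁ , hi k≤y₁ , sym (shift-≥ (≤-trans c≤k k≤y₁))
Sub-shift-below-var⁻ {k} {c} y σ c≤k | inj₂ c≤y | u ∷ [] with Sub-≡var⁻ (shift-≥ c≤y) σ
...   | hit refl = u , hit , refl
Sub-shift-below-var⁻ {k} {c} y σ c≤k | _ | _ ∷ _ ∷ _ with shift-var c y
... | y' , eq with Sub-≡var⁻ eq σ
... | ()

mutual
  Sub-shift-below⁻ : ∀ {k c} s {us v'} → Sub (suc k) (shift c s) (shiftBag c us) v' → c ≤ k →
    ∃ λ v → Sub k s us v × v' ≡ shift c v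
  Sub-shift-below⁻ (var y) σ c≤k = Sub-shift-below-var⁻ y σ c≤k
  Sub-shift-below⁻ {k} {c} (lam s) {us} (lam σ) c≤k
    with Sub-shift-below⁻ s (subst (λ z → Sub (suc (suc k)) _ z _) (sym (shiftBag-shiftBag {0} {c} z≤n us)) σ)
                          (s≤s c≤k)
  ... | v , σ' , refl = lam v , lam σ' , refl
  Sub-shift-below⁻ {k} {c} (app s ts) {us} (app {us₁ = a} {b} p σ τ) c≤k
    with shiftBag-↭-++⁻ c {us} {a} {b} p
  ... | a₀ , b₀ , q , refl , refl with Sub-shift-below⁻ s σ c≤k | SubB-shift-below⁻ ts τ c≤k
  ... | v , σ' , refl | vs , τ' , refl = app v vs , app q σ' τ' , refl

  SubB-shift-below⁻ : ∀ {k c} ts {us vs'} → SubB (suc k) (shiftBag c ts) (shiftBag c us) vs' → c ≤ k →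
    ∃ λ vs → SubB k ts us vs × vs' ≡ shiftBag c vs
  SubB-shift-below⁻ [] {[]} [] c≤k = [] , [] , refl
  SubB-shift-below⁻ (t ∷ ts) {us} (cons {us₁ = a} {b} p σ τ) c≤k with shiftBag-↭-++⁻ _ {us} {a} {b} p
  ... | a₀ , b₀ , q , refl , refl with Sub-shift-below⁻ t σ c≤k | SubB-shift-below⁻ ts τ c≤k
  ... | v , σ' , refl | vs , τ' , refl = v ∷ vs , cons q σ' τ' , refl


mutual
  Sub-shift-[] : ∀ j u → Sub j (shift j u) [] u
  Sub-shift-[] j (var y) with <-≤-connex y j
  ... | inj₁ y<j rewrite shift-< y<j = lo y<j
  ... | inj₂ j≤y rewrite shift-≥ j≤y = hi j≤y
  Sub-shift-[] j (lam u) = lam (Sub-shift-[] (suc j) u)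
  Sub-shift-[] j (app u us) = app ↭-refl (Sub-shift-[] j u) (SubB-shift-[] j us)

  SubB-shift-[] : ∀ j us → SubB j (shiftBag j us) [] us
  SubB-shift-[] j [] = []
  SubB-shift-[] j (u ∷ us) = cons ↭-refl (Sub-shift-[] j u) (SubB-shift-[] j us)

-- j does not occur free in shift j u, so only the empty bag can be substituted for it.
mutual
  Sub-shift-[]⁻ : ∀ j u {vs w} → Sub j (shift j u) vs w → vs ≡ [] × w ≡ u
  Sub-shift-[]⁻ j (var y) σ with <-≤-connex y j
  ... | inj₁ y<j with Sub-≡var⁻ (shift-< y<j) σ
  ...   | hit refl = ⊥-elim (<-irrefl refl y<j)
  ...   | lo _ = refl , refl
  ...   | hi refl j≤y = ⊥-elim (<⇒≱ y<j (m≤n⇒m≤1+n j≤y))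
  Sub-shift-[]⁻ j (var y) σ | inj₂ j≤y with Sub-≡var⁻ (shift-≥ j≤y) σ
  ...   | hit refl = ⊥-elim (<-irrefl refl j≤y)
  ...   | lo y<j = ⊥-elim (<⇒≱ y<j (m≤n⇒m≤1+n j≤y))
  ...   | hi refl _ = refl , refl
  Sub-shift-[]⁻ j (lam u) (lam σ) with Sub-shift-[]⁻ (suc j) u σ
  ... | eq , refl = shiftBag-≡[] 0 eq , refl
  Sub-shift-[]⁻ j (app u us) (app p σ τ) with Sub-shift-[]⁻ j u σ | SubB-shift-[]⁻ j us τ
  ... | refl , refl | refl , refl = ↭-empty-inv p , refl

  SubB-shift-[]⁻ : ∀ j us {vs ws} → SubB j (shiftBag j us) vs ws → vs ≡ [] × ws ≡ us
  SubB-shift-[]⁻ j [] [] = refl , refl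
  SubB-shift-[]⁻ j (u ∷ us) (cons p σ τ) with Sub-shift-[]⁻ j u σ | SubB-shift-[]⁻ j us τ
  ... | refl , refl | refl , refl = ↭-empty-inv p , refl

splits-↭ : ∀ {A : Set} (us : List A) {l r} → (l , r) ∈ splits us → us ↭ l ++ r
splits-↭ [] (here refl) = ↭-refl
splits-↭ (x ∷ xs) m with find (∈-concatMap⁻ _ {xs = splits xs} m)
... | (l₀ , r₀) , m₀ , here refl = prep x (splits-↭ xs m₀)
... | (l₀ , r₀) , m₀ , there (here refl) =
  ↭-trans (prep x (splits-↭ xs m₀)) (↭-sym (↭-shift x l₀ r₀))

splits-complete : ∀ {A : Set} (us : List A) {l r} → us ↭ l ++ r →
  ∃₂ λ l' r' → (l' , r') ∈ splits us × l' ↭ l × r' ↭ r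
splits-complete [] {l} {r} p
  with refl ← ++-conicalˡ l r (↭-empty-inv (↭-sym p)) | refl ← ↭-empty-inv (↭-sym p)
  = [] , [] , here refl , ↭-refl , ↭-refl
splits-complete (x ∷ xs) {l} {r} p with ∈-++⁻ l (∈-resp-↭ p (here refl))
... | inj₁ x∈l with ∈-∃++ x∈l
...   | l₁ , l₂ , refl with splits-complete xs {l₁ ++ l₂} {r}
          (↭-trans (drop-mid [] l₁ (↭-trans p (↭-reflexive (++-assoc l₁ (x ∷ l₂) r))))
                   (↭-reflexive (sym (++-assoc l₁ l₂ r))))
...     | l' , r' , m , q₁ , q₂ =
          x ∷ l' , r' , ∈-concatMap⁺ _ (lose m (here refl)) ,
          ↭-trans (prep x q₁) (↭-sym (↭-shift x l₁ l₂)) , q₂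
splits-complete (x ∷ xs) {l} {r} p | inj₂ x∈r with ∈-∃++ x∈r
...   | r₁ , r₂ , refl with splits-complete xs {l} {r₁ ++ r₂}
          (↭-trans (drop-mid [] (l ++ r₁) (↭-trans p (↭-reflexive (sym (++-assoc l r₁ (x ∷ r₂))))))
                   (↭-reflexive (++-assoc l r₁ r₂)))
...     | l' , r' , m , q₁ , q₂ =
          l' , x ∷ r' , ∈-concatMap⁺ _ (lose m (there (here refl))) , q₁ ,
          ↭-trans (prep x q₂) (↭-sym (↭-shift x r₁ r₂))

mutual
  msub⇒Sub : ∀ k s us {v} → v ∈ msub k s us → Sub k s us v
  msub⇒Sub k (var y) us m with y ≟ k | y <? k
  msub⇒Sub k (var y) (u ∷ []) (here refl) | yes refl | _ = hit
  msub⇒Sub k (var y) [] (here refl) | no _ | yes y<k = lo y<k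
  msub⇒Sub k (var zero) [] (here refl) | no y≢k | no y≮k =
    ⊥-elim (y≢k (sym (n≤0⇒n≡0 (≮⇒≥ y≮k))))
  msub⇒Sub k (var (suc y)) [] (here refl) | no y≢k | no y≮k =
    hi (s≤s⁻¹ (≤∧≢⇒< (≮⇒≥ y≮k) (y≢k ∘ sym)))
  msub⇒Sub k (lam s) us m with ∈-map⁻ lam m
  ... | v , m' , refl = lam (msub⇒Sub (suc k) s (shiftBag 0 us) m')
  msub⇒Sub k (app s ts) us m with find (∈-concatMap⁻ _ {xs = splits us} m)
  ... | (l , r) , ml , m₁ with find (∈-concatMap⁻ _ {xs = msub k s l} m₁)
  ... | s' , ms' , m₂ with ∈-map⁻ (app s') m₂
  ... | vs , mvs , refl = app (splits-↭ us ml) (msub⇒Sub k s l ms') (msubBag⇒SubB k ts r mvs)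

  msubBag⇒SubB : ∀ k ts us {vs} → vs ∈ msubBag k ts us → SubB k ts us vs
  msubBag⇒SubB k [] [] (here refl) = []
  msubBag⇒SubB k (t ∷ ts) us m with find (∈-concatMap⁻ _ {xs = splits us} m)
  ... | (l , r) , ml , m₁ with find (∈-concatMap⁻ _ {xs = msub k t l} m₁)
  ... | t' , mt' , m₂ with ∈-map⁻ (t' ∷_) m₂
  ... | vs , mvs , refl = cons (splits-↭ us ml) (msub⇒Sub k t l mt') (msubBag⇒SubB k ts r mvs)

mutual
  Sub⇒msub : ∀ {k s us v} → Sub k s us v → v ∈ msub k s us
  Sub⇒msub {k} hit with k ≟ k | k <? k
  ... | yes refl | _ = here refl
  ... | no k≢k | _ = ⊥-elim (k≢k refl)
  Sub⇒msub {k} (lo {y = y} y<k) with y ≟ k | y <? k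
  ... | yes refl | _ = ⊥-elim (<-irrefl refl y<k)
  ... | no _ | yes _ = here refl
  ... | no _ | no y≮k = ⊥-elim (y≮k y<k)
  Sub⇒msub {k} (hi {y = y} k≤y) with suc y ≟ k | suc y <? k
  ... | yes refl | _ = ⊥-elim (<-irrefl refl k≤y)
  ... | no _ | yes y<k = ⊥-elim (<⇒≱ y<k (m≤n⇒m≤1+n k≤y))
  ... | no _ | no _ = here refl
  Sub⇒msub (lam σ) = ∈-map⁺ lam (Sub⇒msub σ)
  Sub⇒msub {us = us} (app p σ τ) with splits-complete us p
  ... | l' , r' , m , q₁ , q₂ =
    ∈-concatMap⁺ _ (lose m (∈-concatMap⁺ _ (lose (Sub⇒msub (Sub-resp-↭ σ (↭-sym q₁)))
      (∈-map⁺ (app _) (SubB⇒msubBag (SubB-resp-↭ τ (↭-sym q₂)))))))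

  SubB⇒msubBag : ∀ {k ts us vs} → SubB k ts us vs → vs ∈ msubBag k ts us
  SubB⇒msubBag [] = here refl
  SubB⇒msubBag {us = us} (cons p σ τ) with splits-complete us p
  ... | l' , r' , m , q₁ , q₂ =
    ∈-concatMap⁺ _ (lose m (∈-concatMap⁺ _ (lose (Sub⇒msub (Sub-resp-↭ σ (↭-sym q₁)))
      (∈-map⁺ (_ ∷_) (SubB⇒msubBag (SubB-resp-↭ τ (↭-sym q₂)))))))

mutual
  data Step : RTerm → RTerm → Set where
    β    : ∀ {s ts u} → Sub 0 s ts u → Step (app (lam s) ts) u
    lam  : ∀ {s s'} → Step s s' → Step (lam s) (lam s')
    appˡ : ∀ {s s' ts} → Step s s' → Step (app s ts) (app s' ts)
    appʳ : ∀ {s ts ts'} → StepB ts ts' → Step (app s ts) (app s ts')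

  data StepB : Bag → Bag → Set where
    here  : ∀ {t t' ts} → Step t t' → StepB (t ∷ ts) (t' ∷ ts)
    there : ∀ {t ts ts'} → StepB ts ts' → StepB (t ∷ ts) (t ∷ ts')

Steps : RTerm → RTerm → Set
Steps = Star Step

StepsB : Bag → Bag → Set
StepsB = Star StepB

mutual
  ⟶⇒Step : ∀ {s es u} → s ⟶ es → u ∈ es → Step s u
  ⟶⇒Step (β s ts) m = β (msub⇒Sub 0 s ts m)
  ⟶⇒Step (lamc r) m with ∈-map⁻ lam m
  ... | u , m' , refl = lam (⟶⇒Step r m')
  ⟶⇒Step (appl ts r) m with ∈-map⁻ (λ s' → app s' ts) m
  ... | u , m' , refl = appˡ (⟶⇒Step r m')
  ⟶⇒Step (appr s r) m with ∈-map⁻ (app s) m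
  ... | us , m' , refl = appʳ (⟶b⇒StepB r m')

  ⟶b⇒StepB : ∀ {ts bs us} → ts ⟶b bs → us ∈ bs → StepB ts us
  ⟶b⇒StepB (here ts r) m with ∈-map⁻ (_∷ ts) m
  ... | u , m' , refl = here (⟶⇒Step r m')
  ⟶b⇒StepB (there t r) m with ∈-map⁻ (t ∷_) m
  ... | us , m' , refl = there (⟶b⇒StepB r m')

mutual
  Step⇒⟶ : ∀ {s u} → Step s u → ∃ λ es → s ⟶ es × u ∈ es
  Step⇒⟶ (β {s} {ts} σ) = msub 0 s ts , β s ts , Sub⇒msub σ
  Step⇒⟶ (lam r) with Step⇒⟶ r
  ... | es , r' , m = map lam es , lamc r' , ∈-map⁺ lam m
  Step⇒⟶ (appˡ {ts = ts} r) with Step⇒⟶ r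
  ... | es , r' , m = _ , appl ts r' , ∈-map⁺ (λ s' → app s' ts) m
  Step⇒⟶ (appʳ {s = s} r) with StepB⇒⟶b r
  ... | bs , r' , m = _ , appr s r' , ∈-map⁺ (app s) m

  StepB⇒⟶b : ∀ {ts us} → StepB ts us → ∃ λ bs → ts ⟶b bs × us ∈ bs
  StepB⇒⟶b (here {ts = ts} r) with Step⇒⟶ r
  ... | es , r' , m = _ , here ts r' , ∈-map⁺ (_∷ ts) m
  StepB⇒⟶b (there {t = t} r) with StepB⇒⟶b r
  ... | bs , r' , m = _ , there t r' , ∈-map⁺ (t ∷_) m

⟶s*⇒Steps : ∀ {L L' x} → L ⟶s* L' → x ∈ L' → ∃ λ y → y ∈ L × Steps y x
⟶s*⇒Steps ε m = _ , m , ε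
⟶s*⇒Steps (step L₁ {e} L₂ r ◅ rs) m with ⟶s*⇒Steps rs m
... | y , y∈ , ss with ∈-++⁻ L₁ y∈
... | inj₁ y∈L₁ = y , ∈-++⁺ˡ y∈L₁ , ss
... | inj₂ y∈rest with ∈-++⁻ _ y∈rest
...   | inj₁ y∈es = e , ∈-++⁺ʳ L₁ (here refl) , (⟶⇒Step r y∈es ◅ ss)
...   | inj₂ y∈L₂ = y , ∈-++⁺ʳ L₁ (there y∈L₂) , ss

Steps⇒⟶s* : ∀ {L y x} → y ∈ L → Steps y x → ∃ λ L' → L ⟶s* L' × x ∈ L'
Steps⇒⟶s* m ε = _ , ε , m
Steps⇒⟶s* m (r ◅ rs) with ∈-∃++ m
... | L₁ , L₂ , refl with Step⇒⟶ r
... | es , r' , m' with Steps⇒⟶s* (∈-++⁺ʳ L₁ (∈-++⁺ˡ {ys = L₂} m')) rs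
... | L' , rs' , m'' = L' , (step L₁ L₂ r' ◅ rs') , m''

⇝*⇒Steps : ∀ {e e'} → e ⇝* e' → ∃ λ x → Steps e x × e' ≈ x
⇝*⇒Steps (L , rs , e'∈L) with find e'∈L
... | x , x∈L , e'≈x with ⟶s*⇒Steps rs x∈L
... | _ , here refl , ss = x , ss , e'≈x

Steps⇒⇝* : ∀ {e e' x} → Steps e x → e' ≈ x → e ⇝* e'
Steps⇒⇝* ss e'≈x with Steps⇒⟶s* (here refl) ss
... | L' , rs , x∈L' = L' , rs , lose x∈L' e'≈x

SubB-++ : ∀ {k ts₁ ts₂ a b vs₁ vs₂} → SubB k ts₁ a vs₁ → SubB k ts₂ b vs₂ →
  SubB k (ts₁ ++ ts₂) (a ++ b) (vs₁ ++ vs₂)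
SubB-++ [] τ = τ
SubB-++ {b = b} (cons {us₁ = a₁} {a₂} p σ τ) τ' =
  cons (↭-trans (++⁺ʳ b p) (↭-reflexive (++-assoc a₁ a₂ b))) σ (SubB-++ τ τ')

SubB-++⁻ : ∀ {k ts us} c {d} → SubB k ts us (c ++ d) →
  ∃₂ λ tc td → ∃₂ λ uc ud → ts ≡ tc ++ td × us ↭ uc ++ ud × SubB k tc uc c × SubB k td ud d
SubB-++⁻ [] τ = [] , _ , [] , _ , refl , ↭-refl , [] , τ
SubB-++⁻ (x ∷ c) (cons {t = t} {us₁ = a} p σ τ) with SubB-++⁻ c τ
... | tc , td , uc , ud , refl , q , τc , τd =
  t ∷ tc , td , a ++ uc , ud , refl ,
  ↭-trans p (↭-trans (++⁺ˡ a q) (↭-reflexive (sym (++-assoc a uc ud)))) ,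
  cons ↭-refl σ τc , τd

SubB-↭-result : ∀ {k ts us vs vs'} → SubB k ts us vs → vs ↭ vs' →
  ∃ λ ts' → ts ↭ ts' × SubB k ts' us vs'
SubB-↭-result τ ↭.refl = _ , ↭-refl , τ
SubB-↭-result (cons p σ τ) (↭.prep x q) with SubB-↭-result τ q
... | ts' , r , τ' = _ , prep _ r , cons p σ τ'
SubB-↭-result (cons {us₁ = a} p σ₁ (cons {us₁ = c} p' σ₂ τ)) (↭.swap x y q) with SubB-↭-result τ q
... | ts' , r , τ' =
  _ , swap _ _ r , cons (↭-trans p (↭-trans (++⁺ˡ a p') (shifts a c))) σ₂ (cons ↭-refl σ₁ τ')
SubB-↭-result τ (↭.trans q₁ q₂) with SubB-↭-result τ q₁
... | ts₁ , r₁ , τ₁ with SubB-↭-result τ₁ q₂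
... | ts₂ , r₂ , τ₂ = ts₂ , ↭-trans r₁ r₂ , τ₂

SubB-↭-terms : ∀ {k ts us vs ts'} → SubB k ts us vs → ts ↭ ts' →
  ∃ λ vs' → vs ↭ vs' × SubB k ts' us vs'
SubB-↭-terms τ ↭.refl = _ , ↭-refl , τ
SubB-↭-terms (cons p σ τ) (↭.prep x q) with SubB-↭-terms τ q
... | vs' , r , τ' = _ , prep _ r , cons p σ τ'
SubB-↭-terms (cons {us₁ = a} p σ₁ (cons {us₁ = c} p' σ₂ τ)) (↭.swap x y q) with SubB-↭-terms τ q
... | vs' , r , τ' =
  _ , swap _ _ r , cons (↭-trans p (↭-trans (++⁺ˡ a p') (shifts a c))) σ₂ (cons ↭-refl σ₁ τ')
SubB-↭-terms τ (↭.trans q₁ q₂) with SubB-↭-terms τ q₁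
... | vs₁ , r₁ , τ₁ with SubB-↭-terms τ₁ q₂
... | vs₂ , r₂ , τ₂ = vs₂ , ↭-trans r₁ r₂ , τ₂

SubB-[]⁻ : ∀ {k q̄ us} → SubB k q̄ us [] → q̄ ≡ [] × us ≡ []
SubB-[]⁻ [] = refl , refl

SubB-[-]⁻ : ∀ {k q̄ us w} → SubB k q̄ us (w ∷ []) → ∃ λ q → q̄ ≡ q ∷ [] × Sub k q us w
SubB-[-]⁻ (cons {us₁ = a} p σ []) = _ , refl , Sub-resp-↭ σ (↭-sym (↭-trans p (↭-++-identityʳ a)))

-- The substitution lemma: p⟨q̄/j⟩⟨ū/j+k⟩ is the sum of the p⟨ū₁/j+k+1⟩⟨q̄⟨ū₂/j+k⟩/j⟩
-- over the splittings ū ↭ ū₁ ++ ū₂.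
record Interchange (j k : ℕ) (p : RTerm) (q̄ us : Bag) (w : RTerm) : Set where
  constructor interchange
  field
    {us₁ us₂ q̄'} : Bag
    {p'} : RTerm
    split : us ↭ us₁ ++ us₂
    sub-p : Sub (suc (j + k)) p (shiftBag j us₁) p'
    sub-q̄ : SubB (j + k) q̄ us₂ q̄'
    sub-w : Sub j p' q̄' w

record InterchangeB (j k : ℕ) (ps q̄ us ws : Bag) : Set where
  constructor interchange
  field
    {us₁ us₂ q̄' ps'} : Bag
    split : us ↭ us₁ ++ us₂
    sub-p : SubB (suc (j + k)) ps (shiftBag j us₁) ps'
    sub-q̄ : SubB (j + k) q̄ us₂ q̄'
    sub-w : SubB j ps' q̄' ws

mutual
  Sub-interchange : ∀ {j k p q̄ r us w} → Sub j p q̄ r → Sub (j + k) r us w → Interchange j k p q̄ us w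
  Sub-interchange {j} {k} hit σ =
    interchange {us₁ = []} ↭-refl (lo (s≤s (m≤m+n j k))) (cons (↭-sym (↭-++-identityʳ _)) σ []) hit
  Sub-interchange {j} {k} (lo y<j) σ with Sub-var⁻ σ
  ... | hit refl = ⊥-elim (<⇒≱ y<j (m≤m+n j k))
  ... | lo _ = interchange {us₁ = []} ↭-refl (lo (<-≤-trans y<j (m≤n⇒m≤1+n (m≤m+n j k)))) [] (lo y<j)
  ... | hi refl j+k≤y = ⊥-elim (<⇒≱ y<j (≤-trans (m≤m+n j k) (m≤n⇒m≤1+n j+k≤y)))
  Sub-interchange {j} {k} (hi j≤y) σ with Sub-var⁻ σ
  ... | lo y<j+k = interchange {us₁ = []} ↭-refl (lo (s≤s y<j+k)) [] (hi j≤y)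
  ... | hit {u} refl = interchange {us₁ = u ∷ []} ↭-refl hit [] (Sub-shift-[] j u)
  ... | hi refl j+k≤y =
    interchange {us₁ = []} ↭-refl (hi (s≤s j+k≤y)) [] (hi (≤-trans (m≤m+n j k) j+k≤y))
  Sub-interchange {j} {k} (lam {s = p} {us = q̄} σ₁) (lam σ₂) with Sub-interchange {suc j} {k} σ₁ σ₂
  ... | interchange {us₁'} {us₂'} split sub-p sub-q̄ sub-w with shiftBag-↭-++⁻ 0 {_} {us₁'} {us₂'} split
  ... | us₁ , us₂ , split' , refl , refl with SubB-shift-below⁻ q̄ sub-q̄ z≤n
  ... | q̄' , sub-q̄' , refl =
    interchange split' (lam (subst (λ z → Sub _ p z _) (shiftBag-shiftBag z≤n us₁) sub-p)) sub-q̄' (lam sub-w)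
  Sub-interchange {j} (app π σa τb) (app π₂ σ₂a τ₂b)
    with Sub-interchange σa σ₂a | SubB-interchange τb τ₂b
  ... | interchange {ua₁} {ua₂} splitA pA q̄A wA | interchange {ub₁} {ub₂} splitB pB q̄B wB
    with SubB-↭-terms (SubB-++ q̄A q̄B) (↭-sym π)
  ... | _ , r , q̄AB =
    interchange (↭-trans π₂ (↭-trans (++⁺ splitA splitB) (++-interchange ua₁ ua₂ ub₁ ub₂)))
      (app (↭-reflexive (shiftBag-++ j ua₁ ub₁)) pA pB) q̄AB (app (↭-sym r) wA wB)

  SubB-interchange : ∀ {j k ps q̄ rs us ws} → SubB j ps q̄ rs → SubB (j + k) rs us ws →
    InterchangeB j k ps q̄ us ws
  SubB-interchange [] [] = interchange {us₁ = []} ↭-refl [] [] []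
  SubB-interchange {j} (cons π σa τb) (cons π₂ σ₂a τ₂b)
    with Sub-interchange σa σ₂a | SubB-interchange τb τ₂b
  ... | interchange {ua₁} {ua₂} splitA pA q̄A wA | interchange {ub₁} {ub₂} splitB pB q̄B wB
    with SubB-↭-terms (SubB-++ q̄A q̄B) (↭-sym π)
  ... | _ , r , q̄AB =
    interchange (↭-trans π₂ (↭-trans (++⁺ splitA splitB) (++-interchange ua₁ ua₂ ub₁ ub₂)))
      (cons (↭-reflexive (shiftBag-++ j ua₁ ub₁)) pA pB) q̄AB (cons (↭-sym r) wA wB)

Sub-interchange-var⁻ : ∀ {j k} y {us₁ p' q̄ us₂ q̄' w} → Sub (suc (j + k)) (var y) (shiftBag j us₁) p' →
  SubB (j + k) q̄ us₂ q̄' → Sub j p' q̄' w → ∃ λ r → Sub j (var y) q̄ r × Sub (j + k) r (us₁ ++ us₂) w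
Sub-interchange-var⁻ {j} {k} y {[]} σ₁ τ σ₃ with Sub-var⁻ σ₁
... | lo y≤j+k with Sub-var⁻ σ₃
...   | hit refl with SubB-[-]⁻ τ
...     | q , refl , σq = q , hit , σq
Sub-interchange-var⁻ {j} {k} y {[]} σ₁ τ σ₃ | lo _ | lo y<j with SubB-[]⁻ τ
...     | refl , refl = var y , lo y<j , lo (<-≤-trans y<j (m≤m+n j k))
Sub-interchange-var⁻ {j} {k} y {[]} σ₁ τ σ₃ | lo y≤j+k | hi {y₀} refl j≤y₀ with SubB-[]⁻ τ
...     | refl , refl = var y₀ , hi j≤y₀ , lo (s≤s⁻¹ y≤j+k)
Sub-interchange-var⁻ {j} {k} y {[]} σ₁ τ σ₃ | hi refl j+k<y₀ with Sub-var⁻ σ₃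
...   | hit refl = ⊥-elim (<⇒≱ (s≤s (m≤m+n j k)) j+k<y₀)
...   | lo y₀<j = ⊥-elim (<⇒≱ y₀<j (≤-trans (m≤m+n j k) (≤-trans (n≤1+n _) j+k<y₀)))
...   | hi {y₁} refl j≤y₁ with SubB-[]⁻ τ
...     | refl , refl = var (suc y₁) , hi (m≤n⇒m≤1+n j≤y₁) , hi (s≤s⁻¹ j+k<y₀)
Sub-interchange-var⁻ {j} {k} y {u ∷ []} σ₁ τ σ₃ with Sub-var⁻ σ₁
... | hit refl with Sub-shift-[]⁻ j u σ₃
...   | refl , refl with SubB-[]⁻ τ
...     | refl , refl = var (j + k) , hi (m≤m+n j k) , hit
Sub-interchange-var⁻ y {_ ∷ _ ∷ _} σ₁ τ σ₃ with Sub-var⁻ σ₁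
... | ()

mutual
  Sub-interchange⁻ : ∀ {j k} p {us₁ p' q̄ us₂ q̄' w} → Sub (suc (j + k)) p (shiftBag j us₁) p' →
    SubB (j + k) q̄ us₂ q̄' → Sub j p' q̄' w → ∃ λ r → Sub j p q̄ r × Sub (j + k) r (us₁ ++ us₂) w
  Sub-interchange⁻ (var y) σ₁ τ σ₃ = Sub-interchange-var⁻ y σ₁ τ σ₃
  Sub-interchange⁻ {j} {k} (lam p) {us₁} {us₂ = us₂} (lam σ₁) τ (lam σ₃)
    with Sub-interchange⁻ {suc j} {k} p (subst (λ z → Sub _ p z _) (sym (shiftBag-shiftBag z≤n us₁)) σ₁)
           (SubB-shift-below τ z≤n) σ₃
  ... | r , σr , σw = lam r , lam σr , lam (subst (λ z → Sub _ r z _) (sym (shiftBag-++ 0 us₁ us₂)) σw)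
  Sub-interchange⁻ {j} (app p ps) {us₁} (app {us₁ = A} {B} π₁ σa τb) τ (app {us₁ = C} π₃ σc τd)
    with shiftBag-↭-++⁻ j {us₁} {A} {B} π₁
  ... | a₀ , b₀ , q₁ , refl , refl with SubB-↭-result τ π₃
  ... | _ , r₁ , τ' with SubB-++⁻ C τ'
  ... | _ , _ , uc , ud , refl , q₂ , τc , τd'
    with Sub-interchange⁻ p σa τc σc | SubB-interchange⁻ ps τb τd' τd
  ... | r , σr , σw | rs , τrs , τws =
    app r rs , app r₁ σr τrs , app (↭-trans (++⁺ q₁ q₂) (++-interchange a₀ b₀ uc ud)) σw τws

  SubB-interchange⁻ : ∀ {j k} ps {us₁ ps' q̄ us₂ q̄' ws} → SubB (suc (j + k)) ps (shiftBag j us₁) ps' →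
    SubB (j + k) q̄ us₂ q̄' → SubB j ps' q̄' ws → ∃ λ rs → SubB j ps q̄ rs × SubB (j + k) rs (us₁ ++ us₂) ws
  SubB-interchange⁻ [] {[]} [] τ [] with SubB-[]⁻ τ
  ... | refl , refl = [] , [] , []
  SubB-interchange⁻ {j} (p ∷ ps) {us₁} (cons {us₁ = A} {B} π₁ σa τb) τ (cons {us₁ = C} π₃ σc τd)
    with shiftBag-↭-++⁻ j {us₁} {A} {B} π₁
  ... | a₀ , b₀ , q₁ , refl , refl with SubB-↭-result τ π₃
  ... | _ , r₁ , τ' with SubB-++⁻ C τ'
  ... | _ , _ , uc , ud , refl , q₂ , τc , τd'
    with Sub-interchange⁻ p σa τc σc | SubB-interchange⁻ ps τb τd' τd
  ... | r , σr , σw | rs , τrs , τws =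
    r ∷ rs , cons r₁ σr τrs , cons (↭-trans (++⁺ q₁ q₂) (++-interchange a₀ b₀ uc ud)) σw τws


-- A marking selects some redexes of a term; Dev m t says that t is a summand of the
-- complete development of the marked redexes (fired innermost first).
data Mark : RTerm → Set where
  var   : ∀ {x} → Mark (var x)
  lam   : ∀ {s} → Mark s → Mark (lam s)
  app   : ∀ {s ts} → Mark s → All Mark ts → Mark (app s ts)
  redex : ∀ {s ts} → Mark s → All Mark ts → Mark (app (lam s) ts)

mutual
  data Dev : ∀ {s} → Mark s → RTerm → Set where
    var   : ∀ {x} → Dev (var {x}) (var x)
    lam   : ∀ {s m s'} → Dev {s} m s' → Dev (lam m) (lam s')
    app   : ∀ {s ts m ms s' ts'} → Dev {s} m s' → DevB {ts} ms ts' → Dev (app m ms) (app s' ts')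
    redex : ∀ {s ts m ms s' ts' r} → Dev {s} m s' → DevB {ts} ms ts' → Sub 0 s' ts' r → Dev (redex m ms) r

  data DevB : ∀ {ts} → All Mark ts → Bag → Set where
    []  : DevB [] []
    _∷_ : ∀ {t ts m ms t' ts'} → Dev {t} m t' → DevB {ts} ms ts' → DevB (m ∷ ms) (t' ∷ ts')

mutual
  Mark-shift : ∀ c {s} → Mark s → Mark (shift c s)
  Mark-shift c {var y} var with y <? c
  ... | yes _ = var
  ... | no _ = var
  Mark-shift c (lam m) = lam (Mark-shift (suc c) m)
  Mark-shift c (app m ms) = app (Mark-shift c m) (MarkB-shift c ms)
  Mark-shift c (redex m ms) = redex (Mark-shift (suc c) m) (MarkB-shift c ms)

  MarkB-shift : ∀ c {ts} → All Mark ts → All Mark (shiftBag c ts)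
  MarkB-shift c [] = []
  MarkB-shift c (m ∷ ms) = Mark-shift c m ∷ MarkB-shift c ms

mutual
  Dev-shift : ∀ c {s} {m : Mark s} {w} → Dev m w → Dev (Mark-shift c m) (shift c w)
  Dev-shift c {var y} var with y <? c
  ... | yes _ = var
  ... | no _ = var
  Dev-shift c (lam d) = lam (Dev-shift (suc c) d)
  Dev-shift c (app d ds) = app (Dev-shift c d) (DevB-shift c ds)
  Dev-shift c (redex d ds σ) = redex (Dev-shift (suc c) d) (DevB-shift c ds) (Sub-shift-above σ z≤n)

  DevB-shift : ∀ c {ts} {ms : All Mark ts} {ws} → DevB ms ws → DevB (MarkB-shift c ms) (shiftBag c ws)
  DevB-shift c [] = []
  DevB-shift c (d ∷ ds) = Dev-shift c d ∷ DevB-shift c ds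

mutual
  Dev-shift⁻ : ∀ c {s} (m : Mark s) {w} → Dev (Mark-shift c m) w → ∃ λ w₀ → Dev m w₀ × w ≡ shift c w₀
  Dev-shift⁻ c {var y} var d with y <? c
  Dev-shift⁻ c {var y} var var | yes y<c = var y , var , sym (shift-< y<c)
  Dev-shift⁻ c {var y} var var | no y≮c = var y , var , sym (shift-≥ (≮⇒≥ y≮c))
  Dev-shift⁻ c (lam m) (lam d) with Dev-shift⁻ (suc c) m d
  ... | w₀ , d₀ , refl = lam w₀ , lam d₀ , refl
  Dev-shift⁻ c (app m ms) (app d ds) with Dev-shift⁻ c m d | DevB-shift⁻ c ms ds
  ... | w₀ , d₀ , refl | ws₀ , ds₀ , refl = app w₀ ws₀ , app d₀ ds₀ , refl
  Dev-shift⁻ c (redex m ms) (redex d ds σ) with Dev-shift⁻ (suc c) m d | DevB-shift⁻ c ms ds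
  ... | w₀ , d₀ , refl | ws₀ , ds₀ , refl with Sub-shift-above⁻ w₀ σ z≤n
  ... | r , σ' , refl = r , redex d₀ ds₀ σ' , refl

  DevB-shift⁻ : ∀ c {ts} (ms : All Mark ts) {ws} → DevB (MarkB-shift c ms) ws →
    ∃ λ ws₀ → DevB ms ws₀ × ws ≡ shiftBag c ws₀
  DevB-shift⁻ c [] [] = [] , [] , refl
  DevB-shift⁻ c (m ∷ ms) (d ∷ ds) with Dev-shift⁻ c m d | DevB-shift⁻ c ms ds
  ... | w₀ , d₀ , refl | ws₀ , ds₀ , refl = w₀ ∷ ws₀ , d₀ ∷ ds₀ , refl

mutual
  Mark-sub : ∀ {k a us v} → Sub k a us v → Mark a → All Mark us → Mark v
  Mark-sub hit var (mu ∷ []) = mu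
  Mark-sub (lo _) var _ = var
  Mark-sub (hi _) var _ = var
  Mark-sub (lam σ) (lam m) mus = lam (Mark-sub σ m (MarkB-shift 0 mus))
  Mark-sub (app {us₁ = a} π σ τ) (app m ms) mus =
    app (Mark-sub σ m (++⁻ˡ a (All-resp-↭ π mus))) (MarkB-sub τ ms (++⁻ʳ a (All-resp-↭ π mus)))
  Mark-sub (app {us₁ = a} π (lam σ) τ) (redex m ms) mus =
    redex (Mark-sub σ m (MarkB-shift 0 (++⁻ˡ a (All-resp-↭ π mus))))
          (MarkB-sub τ ms (++⁻ʳ a (All-resp-↭ π mus)))

  MarkB-sub : ∀ {k ts us vs} → SubB k ts us vs → All Mark ts → All Mark us → All Mark vs
  MarkB-sub [] [] _ = []
  MarkB-sub (cons {us₁ = a} π σ τ) (m ∷ ms) mus =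
    Mark-sub σ m (++⁻ˡ a (All-resp-↭ π mus)) ∷ MarkB-sub τ ms (++⁻ʳ a (All-resp-↭ π mus))

DevB-resp-↭⁻ : ∀ {us us'} (π : us ↭ us') (mus : All Mark us) {vs'} → DevB (All-resp-↭ π mus) vs' →
  ∃ λ vs → DevB mus vs × vs ↭ vs'
DevB-resp-↭⁻ ↭.refl mus ds = _ , ds , ↭-refl
DevB-resp-↭⁻ (↭.prep x π) (m ∷ mus) (d ∷ ds) with DevB-resp-↭⁻ π mus ds
... | vs , ds' , q = _ , d ∷ ds' , prep _ q
DevB-resp-↭⁻ (↭.swap x y π) (m₁ ∷ m₂ ∷ mus) (d₂ ∷ d₁ ∷ ds) with DevB-resp-↭⁻ π mus ds
... | vs , ds' , q = _ , d₁ ∷ d₂ ∷ ds' , swap _ _ q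
DevB-resp-↭⁻ (↭.trans π₁ π₂) mus ds with DevB-resp-↭⁻ π₂ (All-resp-↭ π₁ mus) ds
... | vs₁ , ds₁ , q₁ with DevB-resp-↭⁻ π₁ mus ds₁
... | vs , ds' , q = vs , ds' , ↭-trans q q₁

DevB-++⁻ : ∀ a {b} (mus : All Mark (a ++ b)) {x y} →
  DevB (++⁻ˡ a mus) x → DevB (++⁻ʳ a mus) y → DevB mus (x ++ y)
DevB-++⁻ [] mus [] dy = dy
DevB-++⁻ (_ ∷ a) (m ∷ mus) (d ∷ dx) dy = d ∷ DevB-++⁻ a mus dx dy

-- Inside a marked redex this needs the substitution lemma.
mutual
  Dev-sub⁻ : ∀ {k a us v} (σ : Sub k a us v) (ma : Mark a) (mus : All Mark us) {w} →
    Dev (Mark-sub σ ma mus) w → ∃₂ λ a' us' → Dev ma a' × DevB mus us' × Sub k a' us' w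
  Dev-sub⁻ hit var (mu ∷ []) d = _ , _ , var , d ∷ [] , hit
  Dev-sub⁻ (lo y<k) var [] var = _ , [] , var , [] , lo y<k
  Dev-sub⁻ (hi k≤y) var [] var = _ , [] , var , [] , hi k≤y
  Dev-sub⁻ (lam σ) (lam m) mus (lam d) with Dev-sub⁻ σ m (MarkB-shift 0 mus) d
  ... | a₀ , _ , d₀ , ds , σ' with DevB-shift⁻ 0 mus ds
  ... | us' , ds' , refl = lam a₀ , us' , lam d₀ , ds' , lam σ'
  Dev-sub⁻ (app {us₁ = a} π σ τ) (app m ms) mus (app d ds)
    with Dev-sub⁻ σ m (++⁻ˡ a (All-resp-↭ π mus)) d | DevB-sub⁻ τ ms (++⁻ʳ a (All-resp-↭ π mus)) ds
  ... | a₁ , _ , d₁ , dx , σ' | ts' , _ , dts , dy , τ' with DevB-resp-↭⁻ π mus (DevB-++⁻ a _ dx dy)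
  ... | us' , dus , q = app a₁ ts' , us' , app d₁ dts , dus , app q σ' τ'
  Dev-sub⁻ (app {us₁ = a} π (lam σ) τ) (redex m ms) mus (redex d ds σw)
    with Dev-sub⁻ σ m (MarkB-shift 0 (++⁻ˡ a (All-resp-↭ π mus))) d
       | DevB-sub⁻ τ ms (++⁻ʳ a (All-resp-↭ π mus)) ds
  ... | a₀ , _ , d₀ , dx' , σ' | ts' , _ , dts , dy , τ' with DevB-shift⁻ 0 _ dx'
  ... | _ , dx , refl with Sub-interchange⁻ {0} a₀ σ' τ' σw
  ... | r , σr , σr' with DevB-resp-↭⁻ π mus (DevB-++⁻ a _ dx dy)
  ... | us' , dus , q = r , us' , redex d₀ dts σr , dus , Sub-resp-↭ σr' (↭-sym q)

  DevB-sub⁻ : ∀ {k ts us vs} (τ : SubB k ts us vs) (mts : All Mark ts) (mus : All Mark us) {ws} →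
    DevB (MarkB-sub τ mts mus) ws → ∃₂ λ ts' us' → DevB mts ts' × DevB mus us' × SubB k ts' us' ws
  DevB-sub⁻ [] [] [] [] = [] , [] , [] , [] , []
  DevB-sub⁻ (cons {us₁ = a} π σ τ) (m ∷ ms) mus (d ∷ ds)
    with Dev-sub⁻ σ m (++⁻ˡ a (All-resp-↭ π mus)) d | DevB-sub⁻ τ ms (++⁻ʳ a (All-resp-↭ π mus)) ds
  ... | a₁ , _ , d₁ , dx , σ' | ts' , _ , dts , dy , τ' with DevB-resp-↭⁻ π mus (DevB-++⁻ a _ dx dy)
  ... | us' , dus , q = a₁ ∷ ts' , us' , d₁ ∷ dts , dus , cons q σ' τ'

mutual
  Dev-normal : ∀ {x} → Normal x → (m : Mark x) → Dev m x
  Dev-normal (var x) var = var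
  Dev-normal (lam n) (lam m) = lam (Dev-normal n m)
  Dev-normal (app h ns) (app m ms) = app (Dev-normalHead h m) (DevB-normal ns ms)

  Dev-normalHead : ∀ {x} → NormalHead x → (m : Mark x) → Dev m x
  Dev-normalHead (var x) var = var
  Dev-normalHead (app h ns) (app m ms) = app (Dev-normalHead h m) (DevB-normal ns ms)

  DevB-normal : ∀ {ts} → All Normal ts → (ms : All Mark ts) → DevB ms ts
  DevB-normal [] [] = []
  DevB-normal (n ∷ ns) (m ∷ ms) = Dev-normal n m ∷ DevB-normal ns ms

mutual
  Dev⇒Steps : ∀ {s} {m : Mark s} {t} → Dev m t → Steps s t
  Dev⇒Steps var = ε
  Dev⇒Steps (lam d) = gmap lam lam (Dev⇒Steps d)
  Dev⇒Steps {app s ts} (app {s' = s'} d ds) =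
    gmap (λ z → app z ts) appˡ (Dev⇒Steps d) ◅◅ gmap (app s') appʳ (DevB⇒StepsB ds)
  Dev⇒Steps {app (lam s) ts} (redex {s' = s'} d ds σ) =
    gmap (λ z → app (lam z) ts) (appˡ ∘ lam) (Dev⇒Steps d) ◅◅
    gmap (app (lam s')) appʳ (DevB⇒StepsB ds) ◅◅ (β σ ◅ ε)

  DevB⇒StepsB : ∀ {ts} {ms : All Mark ts} {ts'} → DevB ms ts' → StepsB ts ts'
  DevB⇒StepsB [] = ε
  DevB⇒StepsB {t ∷ ts} (_∷_ {t' = t'} d ds) =
    gmap (_∷ ts) here (Dev⇒Steps d) ◅◅ gmap (t' ∷_) there (DevB⇒StepsB ds)

mutual
  Step-shift : ∀ c {u u'} → Step u u' → Step (shift c u) (shift c u')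
  Step-shift c (β σ) = β (Sub-shift-above σ z≤n)
  Step-shift c (lam r) = lam (Step-shift (suc c) r)
  Step-shift c (appˡ r) = appˡ (Step-shift c r)
  Step-shift c (appʳ r) = appʳ (StepB-shift c r)

  StepB-shift : ∀ c {us us'} → StepB us us' → StepB (shiftBag c us) (shiftBag c us')
  StepB-shift c (here r) = here (Step-shift c r)
  StepB-shift c (there r) = there (StepB-shift c r)

mutual
  Sub-Step-body : ∀ {k a a' us w} → Step a a' → Sub k a' us w → ∃ λ w₀ → Sub k a us w₀ × Step w₀ w
  Sub-Step-body {k} (β σ₀) σ with Sub-interchange {0} {k} σ₀ σ
  ... | interchange split sub-p sub-q̄ sub-w = _ , app split (lam sub-p) sub-q̄ , β sub-w
  Sub-Step-body (lam r) (lam σ) with Sub-Step-body r σ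
  ... | w₀ , σ' , r' = lam w₀ , lam σ' , lam r'
  Sub-Step-body (appˡ r) (app π σ τ) with Sub-Step-body r σ
  ... | w₀ , σ' , r' = app w₀ _ , app π σ' τ , appˡ r'
  Sub-Step-body (appʳ r) (app π σ τ) with SubB-Step-body r τ
  ... | ws₀ , τ' , r' = app _ ws₀ , app π σ τ' , appʳ r'

  SubB-Step-body : ∀ {k ts ts' us ws} → StepB ts ts' → SubB k ts' us ws →
    ∃ λ ws₀ → SubB k ts us ws₀ × StepB ws₀ ws
  SubB-Step-body (here r) (cons π σ τ) with Sub-Step-body r σ
  ... | w₀ , σ' , r' = w₀ ∷ _ , cons π σ' τ , here r'
  SubB-Step-body (there r) (cons π σ τ) with SubB-Step-body r τ
  ... | ws₀ , τ' , r' = _ ∷ ws₀ , cons π σ τ' , there r'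

Sub-Steps-body : ∀ {k a a' us w} → Steps a a' → Sub k a' us w → ∃ λ w₀ → Sub k a us w₀ × Steps w₀ w
Sub-Steps-body ε σ = _ , σ , ε
Sub-Steps-body (r ◅ rs) σ with Sub-Steps-body rs σ
... | w₁ , σ₁ , ss with Sub-Step-body r σ₁
... | w₀ , σ₀ , r₀ = w₀ , σ₀ , (r₀ ◅ ss)

[]≢++∷ : ∀ {A : Set} (xs : List A) {y ys} → [] ≢ xs ++ y ∷ ys
[]≢++∷ [] ()
[]≢++∷ (_ ∷ _) ()

[-]≡++∷⁻ : ∀ {A : Set} {x : A} xs {y ys} → x ∷ [] ≡ xs ++ y ∷ ys → xs ≡ [] × ys ≡ [] × x ≡ y
[-]≡++∷⁻ [] refl = refl , refl , refl
[-]≡++∷⁻ (_ ∷ xs) eq = ⊥-elim ([]≢++∷ xs (proj₂ (∷-injective eq)))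

↭-replace-mid : ∀ {A : Set} (xs : List A) {a b ys} zs {ws} →
  xs ++ a ∷ ys ↭ zs ++ a ∷ ws → xs ++ b ∷ ys ↭ zs ++ b ∷ ws
↭-replace-mid xs {a} {b} {ys} zs {ws} p =
  ↭-trans (↭-shift b xs ys) (↭-trans (prep b (drop-mid xs zs p)) (↭-sym (↭-shift b zs ws)))

mutual
  Sub-Step-bag : ∀ {k a us' w u u'} us₁ us₂ → Step u u' → Sub k a us' w → us' ≡ us₁ ++ u' ∷ us₂ →
    ∃ λ w₀ → Sub k a (us₁ ++ u ∷ us₂) w₀ × Step w₀ w
  Sub-Step-bag us₁ us₂ r hit eq with [-]≡++∷⁻ us₁ eq
  ... | refl , refl , refl = _ , hit , r
  Sub-Step-bag us₁ us₂ r (lo _) eq = ⊥-elim ([]≢++∷ us₁ eq)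
  Sub-Step-bag us₁ us₂ r (hi _) eq = ⊥-elim ([]≢++∷ us₁ eq)
  Sub-Step-bag {u = u} {u'} us₁ us₂ r (lam σ) refl
    with Sub-Step-bag (shiftBag 0 us₁) (shiftBag 0 us₂) (Step-shift 0 r) σ (shiftBag-++ 0 us₁ (u' ∷ us₂))
  ... | w₀ , σ' , r' =
    lam w₀ , lam (subst (λ z → Sub _ _ z _) (sym (shiftBag-++ 0 us₁ (u ∷ us₂))) σ') , lam r'
  Sub-Step-bag {u = u} {u'} us₁ us₂ r (app {us₁ = A} {B} π σ τ) refl
    with ∈-++⁻ A (∈-resp-↭ π (∈-insert us₁))
  ... | inj₁ u'∈A with ∈-∃++ u'∈A
  ...   | A₁ , A₂ , refl with Sub-Step-bag A₁ A₂ r σ refl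
  ...     | w₀ , σ' , r' = app w₀ _ ,
            app (↭-trans (↭-replace-mid us₁ A₁ (↭-trans π (↭-reflexive (++-assoc A₁ (u' ∷ A₂) B))))
                         (↭-reflexive (sym (++-assoc A₁ (u ∷ A₂) B)))) σ' τ , appˡ r'
  Sub-Step-bag {u = u} {u'} us₁ us₂ r (app {us₁ = A} {B} π σ τ) refl | inj₂ u'∈B with ∈-∃++ u'∈B
  ...   | B₁ , B₂ , refl with SubB-Step-bag B₁ B₂ r τ refl
  ...     | ws₀ , τ' , r' = app _ ws₀ ,
            app (↭-trans (↭-replace-mid us₁ (A ++ B₁) (↭-trans π (↭-reflexive (sym (++-assoc A B₁ (u' ∷ B₂))))))
                         (↭-reflexive (++-assoc A B₁ (u ∷ B₂)))) σ τ' , appʳ r'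

  SubB-Step-bag : ∀ {k ts us' ws u u'} us₁ us₂ → Step u u' → SubB k ts us' ws → us' ≡ us₁ ++ u' ∷ us₂ →
    ∃ λ ws₀ → SubB k ts (us₁ ++ u ∷ us₂) ws₀ × StepB ws₀ ws
  SubB-Step-bag us₁ us₂ r [] eq = ⊥-elim ([]≢++∷ us₁ eq)
  SubB-Step-bag {u = u} {u'} us₁ us₂ r (cons {us₁ = A} {B} π σ τ) refl
    with ∈-++⁻ A (∈-resp-↭ π (∈-insert us₁))
  ... | inj₁ u'∈A with ∈-∃++ u'∈A
  ...   | A₁ , A₂ , refl with Sub-Step-bag A₁ A₂ r σ refl
  ...     | w₀ , σ' , r' = w₀ ∷ _ ,
            cons (↭-trans (↭-replace-mid us₁ A₁ (↭-trans π (↭-reflexive (++-assoc A₁ (u' ∷ A₂) B))))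
                          (↭-reflexive (sym (++-assoc A₁ (u ∷ A₂) B)))) σ' τ , here r'
  SubB-Step-bag {u = u} {u'} us₁ us₂ r (cons {us₁ = A} {B} π σ τ) refl | inj₂ u'∈B with ∈-∃++ u'∈B
  ...   | B₁ , B₂ , refl with SubB-Step-bag B₁ B₂ r τ refl
  ...     | ws₀ , τ' , r' = _ ∷ ws₀ ,
            cons (↭-trans (↭-replace-mid us₁ (A ++ B₁) (↭-trans π (↭-reflexive (sym (++-assoc A B₁ (u' ∷ B₂))))))
                          (↭-reflexive (++-assoc A B₁ (u ∷ B₂)))) σ τ' , there r'

StepB⇒++∷ : ∀ {us us'} → StepB us us' → ∃₂ λ us₁ us₂ → ∃₂ λ u u' →
  us ≡ us₁ ++ u ∷ us₂ × us' ≡ us₁ ++ u' ∷ us₂ × Step u u'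
StepB⇒++∷ (here r) = [] , _ , _ , _ , refl , refl , r
StepB⇒++∷ (there {t = t} r) with StepB⇒++∷ r
... | us₁ , us₂ , u , u' , refl , refl , r' = t ∷ us₁ , us₂ , u , u' , refl , refl , r'

Sub-Steps-bag : ∀ {k a us us' w} → StepsB us us' → Sub k a us' w → ∃ λ w₀ → Sub k a us w₀ × Steps w₀ w
Sub-Steps-bag ε σ = _ , σ , ε
Sub-Steps-bag (r ◅ rs) σ with Sub-Steps-bag rs σ
... | w₁ , σ₁ , ss with StepB⇒++∷ r
... | us₁ , us₂ , u , u' , refl , refl , r' with Sub-Step-bag us₁ us₂ r' σ₁ refl
... | w₀ , σ₀ , r₀ = w₀ , σ₀ , (r₀ ◅ ss)

Residual : ∀ {s u} → Mark s → Mark u → Set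
Residual m mu = ∀ {w} → Dev mu w → ∃ λ t → Dev m t × Steps t w

ResidualB : ∀ {ts us} → All Mark ts → All Mark us → Set
ResidualB ms mus = ∀ {ws} → DevB mus ws → ∃ λ ts' → DevB ms ts' × StepsB ts' ws

mutual
  residual : ∀ {s u} → Step s u → (m : Mark s) → Σ (Mark u) (Residual m)
  residual (β σ) (app (lam ma) mts) = Mark-sub σ ma mts , λ d →
    let (a' , us' , da , dus , σ') = Dev-sub⁻ σ ma mts d in app (lam a') us' , app (lam da) dus , (β σ' ◅ ε)
  residual (β σ) (redex ma mts) = Mark-sub σ ma mts , λ d →
    let (a' , us' , da , dus , σ') = Dev-sub⁻ σ ma mts d in _ , redex da dus σ' , ε
  residual (lam r) (lam m) with residual r m
  ... | mu , f = lam mu , λ { (lam d) → let (t , dt , ss) = f d in lam t , lam dt , gmap lam lam ss }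
  residual (appˡ r) (app m ms) with residual r m
  ... | mu , f = app mu ms , λ { (app {ts' = ws} d ds) → let (t , dt , ss) = f d in
          app t ws , app dt ds , gmap (λ z → app z ws) appˡ ss }
  residual (appˡ (lam r)) (redex m ms) with residual r m
  ... | mu , f = redex mu ms , λ { (redex d ds σw) → let (t₀ , dt₀ , ss) = f d in
          let (w' , σ' , ss') = Sub-Steps-body ss σw in w' , redex dt₀ ds σ' , ss' }
  residual (appʳ r) (app m ms) with residualB r ms
  ... | ms' , g = app m ms' , λ { (app {s' = w₀} d ds) → let (ts' , dts , ss) = g ds in
          app w₀ ts' , app d dts , gmap (app w₀) appʳ ss }
  residual (appʳ r) (redex m ms) with residualB r ms
  ... | ms' , g = redex m ms' , λ { (redex d ds σw) → let (ts' , dts , ss) = g ds in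
          let (w' , σ' , ss') = Sub-Steps-bag ss σw in w' , redex d dts σ' , ss' }

  residualB : ∀ {ts us} → StepB ts us → (ms : All Mark ts) → Σ (All Mark us) (ResidualB ms)
  residualB (here r) (m ∷ ms) with residual r m
  ... | mu , f = mu ∷ ms , λ { (_∷_ {ts' = ws} d ds) → let (t , dt , ss) = f d in
          t ∷ ws , dt ∷ ds , gmap (_∷ ws) here ss }
  residualB (there r) (m ∷ ms) with residualB r ms
  ... | mus , g = m ∷ mus , λ { (_∷_ {t' = w} d ds) → let (ts' , dts , ss) = g ds in
          w ∷ ts' , d ∷ dts , gmap (w ∷_) there ss }

residual* : ∀ {s x} → Steps s x → (m : Mark s) → Σ (Mark x) (Residual m)
residual* ε m = m , λ d → _ , d , ε
residual* (r ◅ rs) m with residual r m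
... | mu , f with residual* rs mu
... | mx , g = mx , λ d →
  let (t₁ , d₁ , ss₁) = g d
      (t , dt , ss) = f d₁
  in t , dt , (ss ◅◅ ss₁)

mutual
  size : RTerm → ℕ
  size (var _) = 1
  size (lam s) = suc (size s)
  size (app s ts) = suc (size s + sizeB ts)

  sizeB : Bag → ℕ
  sizeB [] = 0
  sizeB (t ∷ ts) = size t + sizeB ts

size≥1 : ∀ s → 1 ≤ size s
size≥1 (var _) = s≤s z≤n
size≥1 (lam s) = s≤s z≤n
size≥1 (app s ts) = s≤s z≤n

sizeB≡sum : ∀ ts → sizeB ts ≡ sum (map size ts)
sizeB≡sum [] = refl
sizeB≡sum (t ∷ ts) = cong (size t +_) (sizeB≡sum ts)

sizeB-++ : ∀ a b → sizeB (a ++ b) ≡ sizeB a + sizeB b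
sizeB-++ [] b = refl
sizeB-++ (t ∷ a) b = trans (cong (size t +_) (sizeB-++ a b)) (sym (+-assoc (size t) (sizeB a) (sizeB b)))

sizeB-↭ : ∀ {us us'} → us ↭ us' → sizeB us ≡ sizeB us'
sizeB-↭ {us} {us'} p = begin
  sizeB us             ≡⟨ sizeB≡sum us ⟩
  sum (map size us)    ≡⟨ sum-↭ (↭-map⁺ size p) ⟩
  sum (map size us')   ≡⟨ sizeB≡sum us' ⟨
  sizeB us'            ∎
  where open ≡-Reasoning

∈⇒size≤sizeB : ∀ {x L} → x ∈ L → size x ≤ sizeB L
∈⇒size≤sizeB {L = y ∷ L} (here refl) = m≤m+n (size y) (sizeB L)
∈⇒size≤sizeB {L = y ∷ L} (there x∈L) = ≤-trans (∈⇒size≤sizeB x∈L) (m≤n+m (sizeB L) (size y))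

mutual
  size-shift : ∀ c s → size (shift c s) ≡ size s
  size-shift c (var y) with shift-var c y
  ... | y' , eq rewrite eq = refl
  size-shift c (lam s) = cong suc (size-shift (suc c) s)
  size-shift c (app s ts) = cong suc (cong₂ _+_ (size-shift c s) (sizeB-shift c ts))

  sizeB-shift : ∀ c ts → sizeB (shiftBag c ts) ≡ sizeB ts
  sizeB-shift c [] = refl
  sizeB-shift c (t ∷ ts) = cong₂ _+_ (size-shift c t) (sizeB-shift c ts)

split-size≤ : ∀ m n {us a b x y} → us ↭ a ++ b →
  x ≤ m + sizeB a → y ≤ n + sizeB b → x + y ≤ (m + n) + sizeB us
split-size≤ m n {us} {a} {b} {x} {y} π x≤ y≤ = begin
  x + y                           ≤⟨ +-mono-≤ x≤ y≤ ⟩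
  (m + sizeB a) + (n + sizeB b)   ≡⟨ +-interchange m (sizeB a) n (sizeB b) ⟩
  (m + n) + (sizeB a + sizeB b)   ≡⟨ cong ((m + n) +_) (trans (sym (sizeB-++ a b)) (sym (sizeB-↭ π))) ⟩
  (m + n) + sizeB us              ∎
  where open ≤-Reasoning

mutual
  Sub-size≤ : ∀ {k s us v} → Sub k s us v → size v ≤ size s + sizeB us
  Sub-size≤ {us = u ∷ []} hit = ≤-trans (m≤m+n (size u) 0) (n≤1+n _)
  Sub-size≤ (lo _) = ≤-refl
  Sub-size≤ (hi _) = ≤-refl
  Sub-size≤ {s = lam s} {us} (lam σ) = s≤s (subst (λ z → _ ≤ size s + z) (sizeB-shift 0 us) (Sub-size≤ σ))
  Sub-size≤ {s = app s ts} (app {us₁ = a} {b} π σ τ) =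
    s≤s (split-size≤ (size s) (sizeB ts) {a = a} {b} π (Sub-size≤ σ) (SubB-size≤ τ))

  SubB-size≤ : ∀ {k ts us vs} → SubB k ts us vs → sizeB vs ≤ sizeB ts + sizeB us
  SubB-size≤ [] = ≤-refl
  SubB-size≤ {ts = t ∷ ts} (cons {us₁ = a} {b} π σ τ) =
    split-size≤ (size t) (sizeB ts) {a = a} {b} π (Sub-size≤ σ) (SubB-size≤ τ)

mutual
  Sub-bag≤ : ∀ {k s us v} → Sub k s us v → sizeB us ≤ size v
  Sub-bag≤ {us = u ∷ []} hit = ≤-reflexive (+-identityʳ (size u))
  Sub-bag≤ (lo _) = z≤n
  Sub-bag≤ (hi _) = z≤n
  Sub-bag≤ {us = us} (lam σ) = ≤-trans (≤-reflexive (sym (sizeB-shift 0 us))) (m≤n⇒m≤1+n (Sub-bag≤ σ))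
  Sub-bag≤ (app {us₁ = a} {b} π σ τ) =
    ≤-trans (≤-reflexive (trans (sizeB-↭ π) (sizeB-++ a b)))
            (m≤n⇒m≤1+n (+-mono-≤ (Sub-bag≤ σ) (SubB-bag≤ τ)))

  SubB-bag≤ : ∀ {k ts us vs} → SubB k ts us vs → sizeB us ≤ sizeB vs
  SubB-bag≤ [] = ≤-refl
  SubB-bag≤ (cons {us₁ = a} {b} π σ τ) =
    ≤-trans (≤-reflexive (trans (sizeB-↭ π) (sizeB-++ a b))) (+-mono-≤ (Sub-bag≤ σ) (SubB-bag≤ τ))

mutual
  Sub-body≤ : ∀ {k s us v} → Sub k s us v → size s ≤ size v
  Sub-body≤ {v = v} hit = size≥1 v
  Sub-body≤ (lo _) = ≤-refl
  Sub-body≤ (hi _) = ≤-refl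
  Sub-body≤ (lam σ) = s≤s (Sub-body≤ σ)
  Sub-body≤ (app π σ τ) = s≤s (+-mono-≤ (Sub-body≤ σ) (SubB-body≤ τ))

  SubB-body≤ : ∀ {k ts us vs} → SubB k ts us vs → sizeB ts ≤ sizeB vs
  SubB-body≤ [] = ≤-refl
  SubB-body≤ (cons π σ τ) = +-mono-≤ (Sub-body≤ σ) (SubB-body≤ τ)

mutual
  Dev-size≤ : ∀ {s} {m : Mark s} {t} → Dev m t → size t ≤ size s
  Dev-size≤ var = ≤-refl
  Dev-size≤ (lam d) = s≤s (Dev-size≤ d)
  Dev-size≤ (app d ds) = s≤s (+-mono-≤ (Dev-size≤ d) (DevB-size≤ ds))
  Dev-size≤ (redex d ds σ) =
    ≤-trans (Sub-size≤ σ) (m≤n⇒m≤1+n (m≤n⇒m≤1+n (+-mono-≤ (Dev-size≤ d) (DevB-size≤ ds))))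

  DevB-size≤ : ∀ {ts} {ms : All Mark ts} {ts'} → DevB ms ts' → sizeB ts' ≤ sizeB ts
  DevB-size≤ [] = ≤-refl
  DevB-size≤ (d ∷ ds) = +-mono-≤ (Dev-size≤ d) (DevB-size≤ ds)

mutual
  FVBelow-mono : ∀ {n m} e → n ≤ m → FVBelow n e → FVBelow m e
  FVBelow-mono (var y) n≤m y<n = <-≤-trans y<n n≤m
  FVBelow-mono (lam s) n≤m fv = FVBelow-mono s (s≤s n≤m) fv
  FVBelow-mono (app s ts) n≤m (fv , fvs) = FVBelow-mono s n≤m fv , FVBelowBag-mono ts n≤m fvs

  FVBelowBag-mono : ∀ {n m} ts → n ≤ m → FVBelowBag n ts → FVBelowBag m ts
  FVBelowBag-mono [] n≤m _ = _
  FVBelowBag-mono (t ∷ ts) n≤m (fv , fvs) = FVBelow-mono t n≤m fv , FVBelowBag-mono ts n≤m fvs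

listsOfLength≤ : ℕ → List RTerm → List Bag
listsOfLength≤ zero xs = [] ∷ []
listsOfLength≤ (suc k) xs = [] ∷ concatMap (λ x → map (x ∷_) (listsOfLength≤ k xs)) xs

termsOfSize≤ : ℕ → ℕ → List RTerm
termsOfSize≤ zero n = []
termsOfSize≤ (suc f) n =
  map var (upTo n) ++
  map lam (termsOfSize≤ f (suc n)) ++
  concatMap (λ s → map (app s) (listsOfLength≤ f (termsOfSize≤ f n))) (termsOfSize≤ f n)

∈-listsOfLength≤ : ∀ k xs ts → All (_∈ xs) ts → length ts ≤ k → ts ∈ listsOfLength≤ k xs
∈-listsOfLength≤ zero xs [] _ _ = here refl
∈-listsOfLength≤ (suc k) xs [] _ _ = here refl
∈-listsOfLength≤ (suc k) xs (t ∷ ts) (t∈ ∷ ts∈) (s≤s len≤k) =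
  there (∈-concatMap⁺ _ (lose t∈ (∈-map⁺ (t ∷_) (∈-listsOfLength≤ k xs ts ts∈ len≤k))))

length≤sizeB : ∀ ts → length ts ≤ sizeB ts
length≤sizeB [] = z≤n
length≤sizeB (t ∷ ts) = +-mono-≤ (size≥1 t) (length≤sizeB ts)

mutual
  ∈-termsOfSize≤ : ∀ f n e → size e ≤ f → FVBelow n e → e ∈ termsOfSize≤ f n
  ∈-termsOfSize≤ zero n e e≤0 fv = ⊥-elim (<⇒≱ (size≥1 e) e≤0)
  ∈-termsOfSize≤ (suc f) n (var y) _ y<n = ∈-++⁺ˡ (∈-map⁺ var (∈-upTo⁺ y<n))
  ∈-termsOfSize≤ (suc f) n (lam s) (s≤s s≤f) fv =
    ∈-++⁺ʳ (map var (upTo n)) (∈-++⁺ˡ (∈-map⁺ lam (∈-termsOfSize≤ f (suc n) s s≤f fv)))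
  ∈-termsOfSize≤ (suc f) n (app s ts) (s≤s e≤f) (fv , fvs) =
    ∈-++⁺ʳ (map var (upTo n)) (∈-++⁺ʳ (map lam (termsOfSize≤ f (suc n)))
      (∈-concatMap⁺ _ (lose (∈-termsOfSize≤ f n s s≤f fv)
        (∈-map⁺ (app s) (∈-listsOfLength≤ f _ ts (All-∈-termsOfSize≤ f n ts ts≤f fvs)
          (≤-trans (length≤sizeB ts) ts≤f))))))
    where
    s≤f = ≤-trans (m≤m+n (size s) (sizeB ts)) e≤f
    ts≤f = ≤-trans (m≤n+m (sizeB ts) (size s)) e≤f

  All-∈-termsOfSize≤ : ∀ f n ts → sizeB ts ≤ f → FVBelowBag n ts → All (_∈ termsOfSize≤ f n) ts
  All-∈-termsOfSize≤ f n [] _ _ = []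
  All-∈-termsOfSize≤ f n (t ∷ ts) ts≤f (fv , fvs) =
    ∈-termsOfSize≤ f n t (≤-trans (m≤m+n (size t) (sizeB ts)) ts≤f) fv ∷
    All-∈-termsOfSize≤ f n ts (≤-trans (m≤n+m (sizeB ts) (size t)) ts≤f) fvs

mutual
  ≈-refl : ∀ t → t ≈ t
  ≈-refl (var x) = var x
  ≈-refl (lam t) = lam (≈-refl t)
  ≈-refl (app t ts) = app (≈-refl t) (≈b-refl ts)

  ≈b-refl : ∀ ts → ts ≈b ts
  ≈b-refl [] = []
  ≈b-refl (t ∷ ts) = _∷_ {us₁ = []} (≈-refl t) (≈b-refl ts)

mutual
  ≈-size : ∀ {s t} → s ≈ t → size s ≡ size t
  ≈-size (var x) = refl
  ≈-size (lam e) = cong suc (≈-size e)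
  ≈-size (app e es) = cong suc (cong₂ _+_ (≈-size e) (≈b-size es))

  ≈b-size : ∀ {ts us} → ts ≈b us → sizeB ts ≡ sizeB us
  ≈b-size [] = refl
  ≈b-size (_∷_ {t} {u} {ts} {us₁} {us₂} e es) = begin
    size t + sizeB ts                 ≡⟨ cong₂ _+_ (≈-size e) (≈b-size es) ⟩
    size u + sizeB (us₁ ++ us₂)       ≡⟨ sizeB-↭ (↭-shift u us₁ us₂) ⟨
    sizeB (us₁ ++ u ∷ us₂)            ∎
    where open ≡-Reasoning

mutual
  ≈-normal : ∀ {s t} → s ≈ t → Normal s → Normal t
  ≈-normal (var x) _ = var x
  ≈-normal (lam e) (lam n) = lam (≈-normal e n)
  ≈-normal (app e es) (app h ns) = app (≈-normalHead e h) (≈b-normal es ns)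

  ≈-normalHead : ∀ {s t} → s ≈ t → NormalHead s → NormalHead t
  ≈-normalHead (var x) _ = var x
  ≈-normalHead (app e es) (app h ns) = app (≈-normalHead e h) (≈b-normal es ns)

  ≈b-normal : ∀ {ts us} → ts ≈b us → All Normal ts → All Normal us
  ≈b-normal [] [] = []
  ≈b-normal (_∷_ {us₁ = us₁} e es) (n ∷ ns) with ++⁻ us₁ (≈b-normal es ns)
  ... | n₁ , n₂ = All-++⁺ n₁ (≈-normal e n ∷ n₂)

module _ {a : Level} {A : Set a} where

  𝒯S-var⁻ : ∀ {x e} → 𝒯S {A = A} (var x) e → e ≡ var x
  𝒯S-var⁻ {x} {var y} refl = refl

  𝒯-lamC⁻ : ∀ (X : CTerm A) {e} → 𝒯 (lamC X) e → ∃ λ s → e ≡ lam s × 𝒯 X s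
  𝒯-lamC⁻ (ι S) {lam s} p = s , refl , p
  𝒯-lamC⁻ (c · X) p = 𝒯-lamC⁻ X p
  𝒯-lamC⁻ (X ⊕ Y) (inj₁ p) with 𝒯-lamC⁻ X p
  ... | s , eq , q = s , eq , inj₁ q
  𝒯-lamC⁻ (X ⊕ Y) (inj₂ p) with 𝒯-lamC⁻ Y p
  ... | s , eq , q = s , eq , inj₂ q

  𝒯-lamC⁺ : ∀ (X : CTerm A) {s} → 𝒯 X s → 𝒯 (lamC X) (lam s)
  𝒯-lamC⁺ (ι S) p = p
  𝒯-lamC⁺ (c · X) p = 𝒯-lamC⁺ X p
  𝒯-lamC⁺ (X ⊕ Y) (inj₁ p) = inj₁ (𝒯-lamC⁺ X p)
  𝒯-lamC⁺ (X ⊕ Y) (inj₂ p) = inj₂ (𝒯-lamC⁺ Y p)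

  𝒯-appC⁻ : ∀ (X P : CTerm A) {e} → 𝒯 (appC X P) e →
    ∃₂ λ s ts → e ≡ app s ts × 𝒯 X s × All (𝒯 P) ts
  𝒯-appC⁻ (ι S) P {app s ts} (p , ps) = s , ts , refl , p , ps
  𝒯-appC⁻ (c · X) P p = 𝒯-appC⁻ X P p
  𝒯-appC⁻ (X ⊕ Y) P (inj₁ p) with 𝒯-appC⁻ X P p
  ... | s , ts , eq , q , qs = s , ts , eq , inj₁ q , qs
  𝒯-appC⁻ (X ⊕ Y) P (inj₂ p) with 𝒯-appC⁻ Y P p
  ... | s , ts , eq , q , qs = s , ts , eq , inj₂ q , qs

  𝒯-appC⁺ : ∀ (X P : CTerm A) {s ts} → 𝒯 X s → All (𝒯 P) ts → 𝒯 (appC X P) (app s ts)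
  𝒯-appC⁺ (ι S) P p ps = p , ps
  𝒯-appC⁺ (c · X) P p ps = 𝒯-appC⁺ X P p ps
  𝒯-appC⁺ (X ⊕ Y) P (inj₁ p) ps = inj₁ (𝒯-appC⁺ X P p ps)
  𝒯-appC⁺ (X ⊕ Y) P (inj₂ p) ps = inj₂ (𝒯-appC⁺ Y P p ps)

  mutual
    𝒯-shiftM⁻ : ∀ c (N : CTerm A) {e} → 𝒯 (shiftM c N) e → ∃ λ e₀ → e ≡ shift c e₀ × 𝒯 N e₀
    𝒯-shiftM⁻ c (ι S) p = 𝒯S-shiftS⁻ c S p
    𝒯-shiftM⁻ c (d · N) p = 𝒯-shiftM⁻ c N p
    𝒯-shiftM⁻ c (N ⊕ P) (inj₁ p) with 𝒯-shiftM⁻ c N p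
    ... | e₀ , eq , q = e₀ , eq , inj₁ q
    𝒯-shiftM⁻ c (N ⊕ P) (inj₂ p) with 𝒯-shiftM⁻ c P p
    ... | e₀ , eq , q = e₀ , eq , inj₂ q

    𝒯S-shiftS⁻ : ∀ c (S : STerm A) {e} → 𝒯S (shiftS c S) e → ∃ λ e₀ → e ≡ shift c e₀ × 𝒯S S e₀
    𝒯S-shiftS⁻ c (var y) {e} p with y <? c
    𝒯S-shiftS⁻ c (var y) {var z} refl | yes y<c = var y , sym (shift-< y<c) , refl
    𝒯S-shiftS⁻ c (var y) {var z} refl | no y≮c = var y , sym (shift-≥ (≮⇒≥ y≮c)) , refl
    𝒯S-shiftS⁻ c (lam S) {lam s} p with 𝒯S-shiftS⁻ (suc c) S p
    ... | s₀ , refl , q = lam s₀ , refl , q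
    𝒯S-shiftS⁻ c (app S N) {app s ts} (p , ps) with 𝒯S-shiftS⁻ c S p | All-𝒯-shiftM⁻ c N ps
    ... | s₀ , refl , q | ts₀ , refl , qs = app s₀ ts₀ , refl , q , qs

    All-𝒯-shiftM⁻ : ∀ c (N : CTerm A) {ts} → All (𝒯 (shiftM c N)) ts →
      ∃ λ ts₀ → ts ≡ shiftBag c ts₀ × All (𝒯 N) ts₀
    All-𝒯-shiftM⁻ c N [] = [] , refl , []
    All-𝒯-shiftM⁻ c N (p ∷ ps) with 𝒯-shiftM⁻ c N p | All-𝒯-shiftM⁻ c N ps
    ... | e₀ , refl , q | ts₀ , refl , qs = e₀ ∷ ts₀ , refl , q ∷ qs

  mutual
    𝒯-shiftM⁺ : ∀ c (N : CTerm A) {e} → 𝒯 N e → 𝒯 (shiftM c N) (shift c e)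
    𝒯-shiftM⁺ c (ι S) p = 𝒯S-shiftS⁺ c S p
    𝒯-shiftM⁺ c (d · N) p = 𝒯-shiftM⁺ c N p
    𝒯-shiftM⁺ c (N ⊕ P) (inj₁ p) = inj₁ (𝒯-shiftM⁺ c N p)
    𝒯-shiftM⁺ c (N ⊕ P) (inj₂ p) = inj₂ (𝒯-shiftM⁺ c P p)

    𝒯S-shiftS⁺ : ∀ c (S : STerm A) {e} → 𝒯S S e → 𝒯S (shiftS c S) (shift c e)
    𝒯S-shiftS⁺ c (var y) {var z} refl with y <? c
    ... | yes _ = refl
    ... | no _ = refl
    𝒯S-shiftS⁺ c (lam S) {lam s} p = 𝒯S-shiftS⁺ (suc c) S p
    𝒯S-shiftS⁺ c (app S N) {app s ts} (p , ps) = 𝒯S-shiftS⁺ c S p , All-𝒯-shiftM⁺ c N ps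

    All-𝒯-shiftM⁺ : ∀ c (N : CTerm A) {ts} → All (𝒯 N) ts → All (𝒯 (shiftM c N)) (shiftBag c ts)
    All-𝒯-shiftM⁺ c N [] = []
    All-𝒯-shiftM⁺ c N (p ∷ ps) = 𝒯-shiftM⁺ c N p ∷ All-𝒯-shiftM⁺ c N ps

  mutual
    𝒯-substM⁻ : ∀ k (N X : CTerm A) {e} → 𝒯 (substM k N X) e →
      ∃₂ λ s us → 𝒯 X s × All (𝒯 N) us × Sub k s us e
    𝒯-substM⁻ k N (ι S) p = 𝒯-substS⁻ k N S p
    𝒯-substM⁻ k N (d · X) p = 𝒯-substM⁻ k N X p
    𝒯-substM⁻ k N (X ⊕ Y) (inj₁ p) with 𝒯-substM⁻ k N X p
    ... | s , us , q , qs , σ = s , us , inj₁ q , qs , σ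
    𝒯-substM⁻ k N (X ⊕ Y) (inj₂ p) with 𝒯-substM⁻ k N Y p
    ... | s , us , q , qs , σ = s , us , inj₂ q , qs , σ

    𝒯-substS⁻ : ∀ k (N : CTerm A) (S : STerm A) {e} → 𝒯 (substS k N S) e →
      ∃₂ λ s us → 𝒯S S s × All (𝒯 N) us × Sub k s us e
    𝒯-substS⁻ k N (var y) {e} p with y ≟ k | y <? k
    ... | yes refl | _ = var y , e ∷ [] , refl , p ∷ [] , hit
    ... | no _ | yes y<k with refl ← 𝒯S-var⁻ {y} {e} p = var y , [] , refl , [] , lo y<k
    𝒯-substS⁻ k N (var zero) {e} p | no y≢k | no y≮k =
      ⊥-elim (y≢k (sym (n≤0⇒n≡0 (≮⇒≥ y≮k))))
    𝒯-substS⁻ k N (var (suc y)) {e} p | no y≢k | no y≮k with refl ← 𝒯S-var⁻ {y} {e} p =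
      var (suc y) , [] , refl , [] , hi (s≤s⁻¹ (≤∧≢⇒< (≮⇒≥ y≮k) (y≢k ∘ sym)))
    𝒯-substS⁻ k N (lam S) p with 𝒯-lamC⁻ (substS (suc k) (shiftM 0 N) S) p
    ... | e' , refl , q with 𝒯-substS⁻ (suc k) (shiftM 0 N) S q
    ... | s , _ , qs , qus , σ with All-𝒯-shiftM⁻ 0 N qus
    ... | us , refl , qus' = lam s , us , qs , qus' , lam σ
    𝒯-substS⁻ k N (app S P) p with 𝒯-appC⁻ (substS k N S) (substM k N P) p
    ... | e₁ , es , refl , q , qs with 𝒯-substS⁻ k N S q | All-𝒯-substM⁻ k N P qs
    ... | s , us₁ , qS , qu₁ , σ | ts , us₂ , qts , qu₂ , τ =
      app s ts , us₁ ++ us₂ , (qS , qts) , All-++⁺ qu₁ qu₂ , app ↭-refl σ τ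

    All-𝒯-substM⁻ : ∀ k (N P : CTerm A) {es} → All (𝒯 (substM k N P)) es →
      ∃₂ λ ts us → All (𝒯 P) ts × All (𝒯 N) us × SubB k ts us es
    All-𝒯-substM⁻ k N P [] = [] , [] , [] , [] , []
    All-𝒯-substM⁻ k N P (q ∷ qs) with 𝒯-substM⁻ k N P q | All-𝒯-substM⁻ k N P qs
    ... | s , us₁ , qS , qu₁ , σ | ts , us₂ , qts , qu₂ , τ =
      s ∷ ts , us₁ ++ us₂ , qS ∷ qts , All-++⁺ qu₁ qu₂ , cons ↭-refl σ τ

  mutual
    𝒯-substM⁺ : ∀ k (N X : CTerm A) {s us e} → 𝒯 X s → All (𝒯 N) us → Sub k s us e →
      𝒯 (substM k N X) e
    𝒯-substM⁺ k N (ι S) p qs σ = 𝒯-substS⁺ k N S p qs σ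
    𝒯-substM⁺ k N (d · X) p qs σ = 𝒯-substM⁺ k N X p qs σ
    𝒯-substM⁺ k N (X ⊕ Y) (inj₁ p) qs σ = inj₁ (𝒯-substM⁺ k N X p qs σ)
    𝒯-substM⁺ k N (X ⊕ Y) (inj₂ p) qs σ = inj₂ (𝒯-substM⁺ k N Y p qs σ)

    𝒯-substS⁺ : ∀ k (N : CTerm A) (S : STerm A) {s us e} → 𝒯S S s → All (𝒯 N) us → Sub k s us e →
      𝒯 (substS k N S) e
    𝒯-substS⁺ k N (var x) {var y} refl qs σ with Sub-var⁻ σ | x ≟ k | x <? k
    𝒯-substS⁺ k N (var x) {var y} refl (q ∷ []) σ | hit refl | yes refl | _ = q
    ... | hit refl | no x≢x | _ = ⊥-elim (x≢x refl)
    ... | lo x<k | yes refl | _ = ⊥-elim (<-irrefl refl x<k)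
    ... | lo x<k | no _ | yes _ = refl
    ... | lo x<k | no _ | no x≮k = ⊥-elim (x≮k x<k)
    ... | hi refl k≤x | yes refl | _ = ⊥-elim (<-irrefl refl k≤x)
    ... | hi refl k≤x | no _ | yes x<k = ⊥-elim (<⇒≱ x<k (m≤n⇒m≤1+n k≤x))
    ... | hi refl k≤x | no _ | no _ = refl
    𝒯-substS⁺ k N (lam S) {lam s} q qus (lam σ) =
      𝒯-lamC⁺ (substS (suc k) (shiftM 0 N) S)
              (𝒯-substS⁺ (suc k) (shiftM 0 N) S q (All-𝒯-shiftM⁺ 0 N qus) σ)
    𝒯-substS⁺ k N (app S P) {app s ts} (q , qts) qus (app {us₁ = a} π σ τ) =
      𝒯-appC⁺ (substS k N S) (substM k N P)
        (𝒯-substS⁺ k N S q (++⁻ˡ a (All-resp-↭ π qus)) σ)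
        (All-𝒯-substM⁺ k N P qts (++⁻ʳ a (All-resp-↭ π qus)) τ)

    All-𝒯-substM⁺ : ∀ k (N P : CTerm A) {ts us es} → All (𝒯 P) ts → All (𝒯 N) us → SubB k ts us es →
      All (𝒯 (substM k N P)) es
    All-𝒯-substM⁺ k N P [] qus [] = []
    All-𝒯-substM⁺ k N P (q ∷ qts) qus (cons {us₁ = a} π σ τ) =
      𝒯-substM⁺ k N P q (++⁻ˡ a (All-resp-↭ π qus)) σ ∷
      All-𝒯-substM⁺ k N P qts (++⁻ʳ a (All-resp-↭ π qus)) τ

suc-≤-* : ∀ X x {a} → a ≤ X * x → suc a ≤ suc X * suc x
suc-≤-* X x {a} a≤ = s≤s (begin
  a              ≤⟨ a≤ ⟩
  X * x          ≤⟨ *-monoʳ-≤ X (n≤1+n x) ⟩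
  X * suc x      ≤⟨ m≤n+m (X * suc x) x ⟩
  x + X * suc x  ∎)
  where open ≤-Reasoning

+-≤-* : ∀ X Y x y {a b} → a ≤ X * x → b ≤ Y * y → a + b ≤ (X + Y) * (x + y)
+-≤-* X Y x y {a} {b} a≤ b≤ = begin
  a + b                        ≤⟨ +-mono-≤ a≤ b≤ ⟩
  X * x + Y * y                ≤⟨ +-mono-≤ (*-monoʳ-≤ X (m≤m+n x y)) (*-monoʳ-≤ Y (m≤n+m y x)) ⟩
  X * (x + y) + Y * (x + y)    ≡⟨ *-distribʳ-+ (x + y) X Y ⟨
  (X + Y) * (x + y)            ∎
  where open ≤-Reasoning

+-≤-*ˡ : ∀ C x y {a b} → a ≤ C * x → b ≤ C * y → a + b ≤ C * (x + y)
+-≤-*ˡ C x y a≤ b≤ = ≤-trans (+-mono-≤ a≤ b≤) (≤-reflexive (sym (*-distribˡ-+ C x y)))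

2+-≤-* : ∀ X Y T {a b} → 1 ≤ T → a ≤ X * T → b ≤ Y * T → 2 + (a + b) ≤ (2 + (X + Y)) * T
2+-≤-* X Y T {a} {b} 1≤T a≤ b≤ = begin
  1 + (1 + (a + b))            ≤⟨ +-mono-≤ 1≤T (+-mono-≤ 1≤T (+-mono-≤ a≤ b≤)) ⟩
  T + (T + (X * T + Y * T))    ≡⟨ cong (λ z → T + (T + z)) (*-distribʳ-+ T X Y) ⟨
  T + (T + (X + Y) * T)        ∎
  where open ≤-Reasoning

module _ {a : Level} {A : Set a} where

  mutual
    ⇛-mark : ∀ {M M' : CTerm A} → M ⇛ M' → ∀ {s} → 𝒯 M s → Mark s
    ⇛-mark (var x) {var y} _ = var
    ⇛-mark (lam d) {lam s} p = lam (⇛-mark d p)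
    ⇛-mark (app d₁ d₂) {app s ts} (p , ps) = app (⇛-mark d₁ p) (⇛-markB d₂ ps)
    ⇛-mark (beta d₁ d₂) {app (lam s) ts} (p , ps) = redex (⇛-mark d₁ p) (⇛-markB d₂ ps)
    ⇛-mark (scal c d) p = ⇛-mark d p
    ⇛-mark (plus d₁ d₂) (inj₁ p) = ⇛-mark d₁ p
    ⇛-mark (plus d₁ d₂) (inj₂ p) = ⇛-mark d₂ p

    ⇛-markB : ∀ {N N' : CTerm A} → N ⇛ N' → ∀ {ts} → All (𝒯 N) ts → All Mark ts
    ⇛-markB d [] = []
    ⇛-markB d (p ∷ ps) = ⇛-mark d p ∷ ⇛-markB d ps

  mutual
    ⇛-Dev-𝒯 : ∀ {M M' : CTerm A} (d : M ⇛ M') {s} (p : 𝒯 M s) {t} → Dev (⇛-mark d p) t → 𝒯 M' t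
    ⇛-Dev-𝒯 (var x) {var y} p var = p
    ⇛-Dev-𝒯 (lam {M' = M''} d) {lam s} p (lam dd) = 𝒯-lamC⁺ M'' (⇛-Dev-𝒯 d p dd)
    ⇛-Dev-𝒯 (app {M' = M''} {N' = N'} d₁ d₂) {app s ts} (p , ps) (app dd dds) =
      𝒯-appC⁺ M'' N' (⇛-Dev-𝒯 d₁ p dd) (⇛-DevB-𝒯 d₂ ps dds)
    ⇛-Dev-𝒯 (beta {M' = M''} {N' = N'} d₁ d₂) {app (lam s) ts} (p , ps) (redex dd dds σ) =
      𝒯-substM⁺ 0 N' M'' (⇛-Dev-𝒯 d₁ p dd) (⇛-DevB-𝒯 d₂ ps dds) σ
    ⇛-Dev-𝒯 (scal c d) p dd = ⇛-Dev-𝒯 d p dd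
    ⇛-Dev-𝒯 (plus d₁ d₂) (inj₁ p) dd = inj₁ (⇛-Dev-𝒯 d₁ p dd)
    ⇛-Dev-𝒯 (plus d₁ d₂) (inj₂ p) dd = inj₂ (⇛-Dev-𝒯 d₂ p dd)

    ⇛-DevB-𝒯 : ∀ {N N' : CTerm A} (d : N ⇛ N') {ts} (ps : All (𝒯 N) ts) {ts'} →
      DevB (⇛-markB d ps) ts' → All (𝒯 N') ts'
    ⇛-DevB-𝒯 d [] [] = []
    ⇛-DevB-𝒯 d (p ∷ ps) (dd ∷ dds) = ⇛-Dev-𝒯 d p dd ∷ ⇛-DevB-𝒯 d ps dds

  mutual
    ⇛-𝒯-Dev : ∀ {M M' : CTerm A} (d : M ⇛ M') {t} → 𝒯 M' t →
      ∃ λ s → Σ (𝒯 M s) λ p → Dev (⇛-mark d p) t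
    ⇛-𝒯-Dev (var x) {var y} refl = var x , refl , var
    ⇛-𝒯-Dev (lam {M' = M''} d) p with 𝒯-lamC⁻ M'' p
    ... | t₀ , refl , q with ⇛-𝒯-Dev d q
    ... | s₀ , p₀ , dd = lam s₀ , p₀ , lam dd
    ⇛-𝒯-Dev (app {M' = M''} {N' = N'} d₁ d₂) p with 𝒯-appC⁻ M'' N' p
    ... | t₀ , ts , refl , q , qs with ⇛-𝒯-Dev d₁ q | ⇛-𝒯-DevB d₂ qs
    ... | s₀ , p₀ , dd | ts₀ , ps₀ , dds = app s₀ ts₀ , (p₀ , ps₀) , app dd dds
    ⇛-𝒯-Dev (beta {M' = M''} {N' = N'} d₁ d₂) p with 𝒯-substM⁻ 0 N' M'' p
    ... | s' , us' , q , qs , σ with ⇛-𝒯-Dev d₁ q | ⇛-𝒯-DevB d₂ qs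
    ... | s₀ , p₀ , dd | ts₀ , ps₀ , dds = app (lam s₀) ts₀ , (p₀ , ps₀) , redex dd dds σ
    ⇛-𝒯-Dev (scal c d) p = ⇛-𝒯-Dev d p
    ⇛-𝒯-Dev (plus d₁ d₂) (inj₁ p) with ⇛-𝒯-Dev d₁ p
    ... | s , q , dd = s , inj₁ q , dd
    ⇛-𝒯-Dev (plus d₁ d₂) (inj₂ p) with ⇛-𝒯-Dev d₂ p
    ... | s , q , dd = s , inj₂ q , dd

    ⇛-𝒯-DevB : ∀ {N N' : CTerm A} (d : N ⇛ N') {ts'} → All (𝒯 N') ts' →
      ∃ λ ts → Σ (All (𝒯 N) ts) λ ps → DevB (⇛-markB d ps) ts'
    ⇛-𝒯-DevB d [] = [] , [] , []
    ⇛-𝒯-DevB d (p ∷ ps) with ⇛-𝒯-Dev d p | ⇛-𝒯-DevB d ps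
    ... | s , q , dd | ts , qs , dds = s ∷ ts , q ∷ qs , dd ∷ dds

  ⇛-weight : ∀ {M M' : CTerm A} → M ⇛ M' → ℕ
  ⇛-weight (var x) = 1
  ⇛-weight (lam d) = suc (⇛-weight d)
  ⇛-weight (app d₁ d₂) = suc (⇛-weight d₁ + ⇛-weight d₂)
  ⇛-weight (beta d₁ d₂) = 2 + (⇛-weight d₁ + ⇛-weight d₂)
  ⇛-weight zero = 0
  ⇛-weight (scal c d) = ⇛-weight d
  ⇛-weight (plus d₁ d₂) = ⇛-weight d₁ + ⇛-weight d₂

  mutual
    ⇛-Dev-size≥ : ∀ {M M' : CTerm A} (d : M ⇛ M') {s} (p : 𝒯 M s) {t} →
      Dev (⇛-mark d p) t → size s ≤ ⇛-weight d * size t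
    ⇛-Dev-size≥ (var x) {var y} p var = s≤s z≤n
    ⇛-Dev-size≥ (lam d) {lam s} p (lam {s' = t} dd) = suc-≤-* (⇛-weight d) (size t) (⇛-Dev-size≥ d p dd)
    ⇛-Dev-size≥ (app d₁ d₂) {app s ts} (p , ps) (app {s' = t} {ts' = ts'} dd dds) =
      suc-≤-* (w₁ + w₂) (size t + sizeB ts')
        (+-≤-* w₁ w₂ (size t) (sizeB ts') (⇛-Dev-size≥ d₁ p dd) (⇛-DevB-size≥ d₂ ps dds))
      where w₁ = ⇛-weight d₁; w₂ = ⇛-weight d₂
    ⇛-Dev-size≥ (beta d₁ d₂) {app (lam s) ts} (p , ps) {t} (redex dd dds σ) =
      2+-≤-* (⇛-weight d₁) (⇛-weight d₂) (size t) (size≥1 t)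
        (≤-trans (⇛-Dev-size≥ d₁ p dd) (*-monoʳ-≤ (⇛-weight d₁) (Sub-body≤ σ)))
                        (≤-trans (⇛-DevB-size≥ d₂ ps dds) (*-monoʳ-≤ (⇛-weight d₂) (Sub-bag≤ σ)))
    ⇛-Dev-size≥ (scal c d) p dd = ⇛-Dev-size≥ d p dd
    ⇛-Dev-size≥ (plus d₁ d₂) (inj₁ p) {t} dd =
      ≤-trans (⇛-Dev-size≥ d₁ p dd) (*-monoˡ-≤ (size t) (m≤m+n (⇛-weight d₁) (⇛-weight d₂)))
    ⇛-Dev-size≥ (plus d₁ d₂) (inj₂ p) {t} dd =
      ≤-trans (⇛-Dev-size≥ d₂ p dd) (*-monoˡ-≤ (size t) (m≤n+m (⇛-weight d₂) (⇛-weight d₁)))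

    ⇛-DevB-size≥ : ∀ {N N' : CTerm A} (d : N ⇛ N') {ts} (ps : All (𝒯 N) ts) {ts'} →
      DevB (⇛-markB d ps) ts' → sizeB ts ≤ ⇛-weight d * sizeB ts'
    ⇛-DevB-size≥ d [] [] = z≤n
    ⇛-DevB-size≥ d (p ∷ ps) (_∷_ {t' = t} {ts' = ts'} dd dds) =
      +-≤-*ˡ (⇛-weight d) (size t) (sizeB ts') (⇛-Dev-size≥ d p dd) (⇛-DevB-size≥ d ps dds)

  mutual
    fvBound : CTerm A → ℕ
    fvBound (ι S) = fvBoundS S
    fvBound 𝟘 = 0
    fvBound (c · M) = fvBound M
    fvBound (M ⊕ N) = fvBound M ⊔ fvBound N

    fvBoundS : STerm A → ℕ
    fvBoundS (var x) = suc x
    fvBoundS (lam S) = fvBoundS S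
    fvBoundS (app S N) = fvBoundS S ⊔ fvBound N

  mutual
    𝒯-FVBelow : ∀ (M : CTerm A) {e} → 𝒯 M e → FVBelow (fvBound M) e
    𝒯-FVBelow (ι S) p = 𝒯S-FVBelow S p
    𝒯-FVBelow (c · M) p = 𝒯-FVBelow M p
    𝒯-FVBelow (M ⊕ N) {e} (inj₁ p) = FVBelow-mono e (m≤m⊔n (fvBound M) (fvBound N)) (𝒯-FVBelow M p)
    𝒯-FVBelow (M ⊕ N) {e} (inj₂ p) = FVBelow-mono e (m≤n⊔m (fvBound M) (fvBound N)) (𝒯-FVBelow N p)

    𝒯S-FVBelow : ∀ (S : STerm A) {e} → 𝒯S S e → FVBelow (fvBoundS S) e
    𝒯S-FVBelow (var x) {var y} refl = ≤-refl
    𝒯S-FVBelow (lam S) {lam s} p = FVBelow-mono s (n≤1+n (fvBoundS S)) (𝒯S-FVBelow S p)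
    𝒯S-FVBelow (app S N) {app s ts} (p , ps) =
      FVBelow-mono s (m≤m⊔n (fvBoundS S) (fvBound N)) (𝒯S-FVBelow S p) ,
      FVBelowBag-mono ts (m≤n⊔m (fvBoundS S) (fvBound N)) (All-𝒯-FVBelowBag N ps)

    All-𝒯-FVBelowBag : ∀ (N : CTerm A) {ts} → All (𝒯 N) ts → FVBelowBag (fvBound N) ts
    All-𝒯-FVBelowBag N [] = _
    All-𝒯-FVBelowBag N (p ∷ ps) = 𝒯-FVBelow N p , All-𝒯-FVBelowBag N ps

SizeBounded : RSet → Set
SizeBounded ℰ = ∀ e' → Normal e' → ∃ λ f → ∀ e → ℰ e → e ⇝* e' → size e ≤ f

𝔑⇒SizeBounded : ∀ {ℰ} → 𝔑 ℰ → SizeBounded ℰ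
𝔑⇒SizeBounded (_ , finite) e' ne' =
  let (L , covers) = finite e' ne' in
  sizeB L , λ e e∈ℰ e⇝e' →
    let (ℓ , ℓ∈L , e≈ℓ) = find (covers e e∈ℰ e⇝e') in
    ≤-trans (≤-reflexive (≈-size e≈ℓ)) (∈⇒size≤sizeB ℓ∈L)

SizeBounded⇒𝔑 : ∀ {ℰ} n → (∀ e → ℰ e → FVBelow n e) → SizeBounded ℰ → 𝔑 ℰ
SizeBounded⇒𝔑 n fv bounded = (n , fv) , λ e' ne' →
  let (f , bound) = bounded e' ne' in
  termsOfSize≤ f n , λ e e∈ℰ e⇝e' →
    lose (∈-termsOfSize≤ f n e (bound e e∈ℰ e⇝e') (fv e e∈ℰ)) (≈-refl e)

module _ {a : Level} {A : Set a} {M M' : CTerm A} (d : M ⇛ M') where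

  ⇛-⇝*⁻ : ∀ {t e'} → 𝒯 M' t → t ⇝* e' → ∃ λ s → 𝒯 M s × s ⇝* e' × size t ≤ size s
  ⇛-⇝*⁻ t∈ t⇝e' =
    let (x , t↠x , e'≈x) = ⇝*⇒Steps t⇝e'
        (s , s∈ , dev) = ⇛-𝒯-Dev d t∈
    in s , s∈ , Steps⇒⇝* (Dev⇒Steps dev ◅◅ t↠x) e'≈x , Dev-size≤ dev

  -- A normal reduct of s is its own development under the residual marking, which
  -- pulls back to a development t of s under the marking of d.
  ⇛-⇝* : ∀ {s e'} → Normal e' → (s∈ : 𝒯 M s) → s ⇝* e' →
    ∃ λ t → 𝒯 M' t × t ⇝* e' × size s ≤ ⇛-weight d * size t
  ⇛-⇝* ne' s∈ s⇝e' =
    let (x , s↠x , e'≈x) = ⇝*⇒Steps s⇝e'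
        (mx , reach) = residual* s↠x (⇛-mark d s∈)
        (t , dev , t↠x) = reach (Dev-normal (≈-normal e'≈x ne') mx)
    in t , ⇛-Dev-𝒯 d s∈ dev , Steps⇒⇝* t↠x e'≈x , ⇛-Dev-size≥ d s∈ dev

  ⇛-TaylorNormalizable : TaylorNormalizable M → TaylorNormalizable M'
  ⇛-TaylorNormalizable tn = SizeBounded⇒𝔑 (fvBound M') (λ _ → 𝒯-FVBelow M') λ e' ne' →
    let (f , bound) = 𝔑⇒SizeBounded tn e' ne' in
    f , λ t t∈ t⇝e' →
      let (s , s∈ , s⇝e' , t≤s) = ⇛-⇝*⁻ t∈ t⇝e' in
      ≤-trans t≤s (bound s s∈ s⇝e')

  ⇛-TaylorNormalizable⁻ : TaylorNormalizable M' → TaylorNormalizable M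
  ⇛-TaylorNormalizable⁻ tn' = SizeBounded⇒𝔑 (fvBound M) (λ _ → 𝒯-FVBelow M) λ e' ne' →
    let (f , bound) = 𝔑⇒SizeBounded tn' e' ne' in
    ⇛-weight d * f , λ s s∈ s⇝e' →
      let (t , t∈ , t⇝e' , s≤wt) = ⇛-⇝* ne' s∈ s⇝e' in
      ≤-trans s≤wt (*-monoʳ-≤ (⇛-weight d) (bound t t∈ t⇝e'))

lemma8p9 : ∀ {c ℓ} (𝒮 : CommutativeSemiring c ℓ)
             (M M' : CTerm (CommutativeSemiring.Carrier 𝒮)) →
             M ⇛ M' → TaylorNormalizable M ⇔ TaylorNormalizable M'
lemma8p9 𝒮 M M' d = mk⇔ (⇛-TaylorNormalizable d) (⇛-TaylorNormalizable⁻ d)
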